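{- Let $L$ be a co-Heyting algebra satisfying the density axiom D1 and the splitting axiom S1. Let $L_0$ be a finite subalgebra of $L$ and let $L_1$ be a finite co-Heyting algebra containing $L_0$ as a subalgebra. Then there exists an embedding of $L_1$ into $L$ which fixes every point of $L_0$.
   Context: A co-Heyting algebra is a bounded distributive lattice $(L,\mathbf{0},\mathbf{1},\vee,\wedge)$ with a binary operation $-$ such that $a-b$ is the least $c\in L$ with $a\le b\vee c$; embeddings and subalgebras are taken in the language $\{\mathbf 0,\mathbf 1,\vee,\wedge,-\}$. For $a,b\in L$ write $b\ll a$ iff $a-b=a$ and $b\le a$. Axiom D1: for all $a,c$ with $c\ll a$ and $a\neq\mathbf 0$ there is $b\neq\mathbf 0$ with $c\ll b\ll a$. Axiom S1: for all $a,b_1,b_2$ with $b_1\vee b_2\ll a$ and $a\ne\mathbf 0$ there are non-zero $a_1,a_2$ with $a-a_2=a_1\ge b_1$, $a-a_1=a_2\ge b_2$, and $a_1\wedge a_2=b_1\wedge b_2$. -}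

module Defs where

open import Data.Nat using (ℕ)
open import Data.Fin using (Fin)
open import Data.Product using (Σ; _×_; _,_)
open import Function.Bundles using (_↔_)
open import Relation.Binary.PropositionalEquality using (_≡_)
open import Relation.Nullary using (¬_)

record CoHeyting : Set₁ where
  infixr 6 _∨_
  infixr 7 _∧_
  infixl 8 _-_
  infix 4 _≤_
  field
    Carrier : Set
    𝟎 𝟏 : Carrier
    _∨_ _∧_ _-_ : Carrier → Carrier → Carrier
    ∨-assoc : ∀ a b c → (a ∨ b) ∨ c ≡ a ∨ (b ∨ c)
    ∧-assoc : ∀ a b c → (a ∧ b) ∧ c ≡ a ∧ (b ∧ c)
    ∨-comm : ∀ a b → a ∨ b ≡ b ∨ a
    ∧-comm : ∀ a b → a ∧ b ≡ b ∧ a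
    ∨-absorbs-∧ : ∀ a b → a ∨ (a ∧ b) ≡ a
    ∧-absorbs-∨ : ∀ a b → a ∧ (a ∨ b) ≡ a
    ∧-distrib-∨ : ∀ a b c → a ∧ (b ∨ c) ≡ (a ∧ b) ∨ (a ∧ c)
    ∨-identity : ∀ a → 𝟎 ∨ a ≡ a
    ∧-identity : ∀ a → 𝟏 ∧ a ≡ a

  _≤_ : Carrier → Carrier → Set
  a ≤ b = a ∧ b ≡ a

  field
    -covers : ∀ a b → a ≤ b ∨ (a - b)
    -least  : ∀ a b c → a ≤ b ∨ c → a - b ≤ c

  _≪_ : Carrier → Carrier → Set
  b ≪ a = (a - b ≡ a) × (b ≤ a)



D1 : CoHeyting → Set
D1 L = ∀ a c → c ≪ a → ¬ (a ≡ 𝟎) →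
         Σ Carrier λ b → ¬ (b ≡ 𝟎) × (c ≪ b) × (b ≪ a)
  where open CoHeyting L

S1 : CoHeyting → Set
S1 L = ∀ a b₁ b₂ → (b₁ ∨ b₂) ≪ a → ¬ (a ≡ 𝟎) →
         Σ Carrier λ a₁ → Σ Carrier λ a₂ →
           ¬ (a₁ ≡ 𝟎) × ¬ (a₂ ≡ 𝟎) ×
           (a - a₂ ≡ a₁) × (b₁ ≤ a₁) ×
           (a - a₁ ≡ a₂) × (b₂ ≤ a₂) ×
           (a₁ ∧ a₂ ≡ b₁ ∧ b₂)
  where open CoHeyting L

Finite : CoHeyting → Set
Finite L = Σ ℕ λ n → CoHeyting.Carrier L ↔ Fin n

record Embedding (A B : CoHeyting) : Set where
  private
    module A = CoHeyting A
    module B = CoHeyting B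
  field
    map : A.Carrier → B.Carrier
    injective : ∀ x y → map x ≡ map y → x ≡ y
    pres-𝟎 : map A.𝟎 ≡ B.𝟎
    pres-𝟏 : map A.𝟏 ≡ B.𝟏
    pres-∨ : ∀ x y → map (x A.∨ y) ≡ map x B.∨ map y
    pres-∧ : ∀ x y → map (x A.∧ y) ≡ map x B.∧ map y
    pres-- : ∀ x y → map (x A.- y) ≡ map x B.- map y

open Embedding public using (map)

-- A finite co-Heyting algebra is the algebra of down-sets of its poset of join-primes, and an
-- embedding L₀ ↪ L₁ dualises to a p-morphism from the join-primes of L₁ onto those of L₀.
-- An embedding of such an algebra into L is determined by its values on the join-primes (a
-- realisation of the poset), so it suffices to lift the realisation of L₀ given by i along this
-- p-morphism. By induction on the size of the poset, a non-injective p-morphism identifies two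
-- points t, z that can be chosen with t either below z or incomparable to it, and it factors
-- through the poset in which t is collapsed onto z. A realisation of the collapsed poset is
-- refined by creating a value for t: below x z by the density axiom D1 in the first case, and by
-- splitting x z with S1 in the second.

module Submission where

open import Defs
open import Data.Bool using (Bool; true; false; if_then_else_; not; T?)
  renaming (_∧_ to _&&_; _∨_ to _||_; _≟_ to _≟ᵇ_)
open import Data.Bool.Properties using (∧-conicalˡ; ∧-conicalʳ; ∨-zeroʳ; not-injective; T-≡)
  renaming (∧-comm to &&-comm)
open import Data.Empty using (⊥-elim)
open import Data.Fin using () renaming (_≟_ to _≟ᶠ_)
open import Data.List using (List; []; _∷_; length; allFin; filter; filterᵇ) renaming (map to mapᴸ)
open import Data.List.Membership.Propositional using (_∈_; find; lose)
open import Data.List.Membership.Propositional.Properties using (∈-map⁺; ∈-allFin; ∈-filter⁺; ∈-filter⁻)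
open import Data.List.Properties using (filter-notAll)
open import Data.List.Relation.Unary.Any as Any using (Any; here; there; any?)
open import Data.Nat using (ℕ; suc; z≤n; s≤s) renaming (_≤_ to _≤ℕ_; _<_ to _<ℕ_)
import Data.Nat.Properties as ℕ
open import Data.Product using (Σ; Σ-syntax; _×_; _,_; proj₁; proj₂)
open import Data.Sum using (_⊎_; inj₁; inj₂; [_,_]′)
open import Function using (_∘_)
open import Function.Bundles using (Inverse; Equivalence)
open import Relation.Nullary using (¬_; yes; no; Dec; does)
open import Relation.Nullary.Decidable using (dec-true; dec-false; ¬?; _×-dec_; map′; decidable-stable)
open import Relation.Binary.Definitions using (DecidableEquality)
open import Relation.Unary using (Decidable)
open import Relation.Binary.PropositionalEquality

&&-intro : ∀ {a b} → a ≡ true → b ≡ true → a && b ≡ true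
&&-intro = cong₂ _&&_

||-introˡ : ∀ {a} b → a ≡ true → a || b ≡ true
||-introˡ b = cong (_|| b)

||-introʳ : ∀ a {b} → b ≡ true → a || b ≡ true
||-introʳ a b≡true = trans (cong (a ||_) b≡true) (∨-zeroʳ a)

||-elim : ∀ {a b} → a || b ≡ true → a ≡ true ⊎ b ≡ true
||-elim {true}  _ = inj₁ refl
||-elim {false} b = inj₂ b

≡true⇒≢false : ∀ {a} → a ≡ true → a ≢ false
≡true⇒≢false refl ()

bool-cases : ∀ {ℓ} {P : Set ℓ} (a : Bool) → (a ≡ true → P) → (a ≡ false → P) → P
bool-cases true  t f = t refl
bool-cases false t f = f refl

module BooleanEquality {A : Set} (_≟_ : DecidableEquality A) where
  infix 7 _==_
  _==_ : A → A → Bool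
  x == y = does (x ≟ y)

  ==⇒≡ : ∀ {x y} → x == y ≡ true → x ≡ y
  ==⇒≡ {x} {y} x==y with x ≟ y
  ... | yes x≡y = x≡y

  ≡⇒== : ∀ {x y} → x ≡ y → x == y ≡ true
  ≡⇒== {x} {y} = dec-true (x ≟ y)

  ≢⇒==false : ∀ {x y} → x ≢ y → x == y ≡ false
  ≢⇒==false {x} {y} = dec-false (x ≟ y)

  ==false⇒≢ : ∀ {x y} → x == y ≡ false → x ≢ y
  ==false⇒≢ x==y≡false x≡y = ≡true⇒≢false (≡⇒== x≡y) x==y≡false

  ∈-filter-≢ : ∀ {t r} {l : List A} → r ∈ filterᵇ (λ s → not (s == t)) l → r ∈ l × r ≢ t
  ∈-filter-≢ {t} r∈l′ with ∈-filter⁻ (T? ∘ (λ s → not (s == t))) r∈l′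
  ... | r∈l , r≠t = r∈l , ==false⇒≢ (not-injective (Equivalence.to T-≡ r≠t))

  ≢-∈-filter : ∀ {t r} {l : List A} → r ∈ l → r ≢ t → r ∈ filterᵇ (λ s → not (s == t)) l
  ≢-∈-filter {t} r∈l r≢t = ∈-filter⁺ (T? ∘ (λ s → not (s == t))) r∈l (Equivalence.from T-≡ (cong not (≢⇒==false r≢t)))

module CoHeytingProperties (L : CoHeyting) where
  open CoHeyting L public
  open ≡-Reasoning

  ∧-idem : ∀ a → a ∧ a ≡ a
  ∧-idem a = trans (cong (a ∧_) (sym (∨-absorbs-∧ a a))) (∧-absorbs-∨ a (a ∧ a))

  ≤-refl : ∀ {a} → a ≤ a
  ≤-refl {a} = ∧-idem a

  ≤-reflexive : ∀ {a b} → a ≡ b → a ≤ b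
  ≤-reflexive refl = ≤-refl

  ≤-respˡ-≡ : ∀ {a a′ b} → a ≡ a′ → a ≤ b → a′ ≤ b
  ≤-respˡ-≡ {b = b} = subst (_≤ b)

  ≤-respʳ-≡ : ∀ {a b b′} → b ≡ b′ → a ≤ b → a ≤ b′
  ≤-respʳ-≡ {a} = subst (a ≤_)

  ≤-trans : ∀ {a b c} → a ≤ b → b ≤ c → a ≤ c
  ≤-trans {a} {b} {c} a≤b b≤c = begin
    a ∧ c       ≡⟨ cong (_∧ c) (sym a≤b) ⟩
    (a ∧ b) ∧ c ≡⟨ ∧-assoc a b c ⟩
    a ∧ (b ∧ c) ≡⟨ cong (a ∧_) b≤c ⟩
    a ∧ b       ≡⟨ a≤b ⟩
    a           ∎

  ≤-antisym : ∀ {a b} → a ≤ b → b ≤ a → a ≡ b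
  ≤-antisym {a} {b} a≤b b≤a = trans (sym a≤b) (trans (∧-comm a b) b≤a)

  x≤y⇒x∨y≡y : ∀ {a b} → a ≤ b → a ∨ b ≡ b
  x≤y⇒x∨y≡y {a} {b} a≤b = begin
    a ∨ b       ≡⟨ cong (_∨ b) (sym a≤b) ⟩
    (a ∧ b) ∨ b ≡⟨ ∨-comm (a ∧ b) b ⟩
    b ∨ (a ∧ b) ≡⟨ cong (b ∨_) (∧-comm a b) ⟩
    b ∨ (b ∧ a) ≡⟨ ∨-absorbs-∧ b a ⟩
    b           ∎

  x≤x∨y : ∀ a b → a ≤ a ∨ b
  x≤x∨y = ∧-absorbs-∨

  y≤x∨y : ∀ a b → b ≤ a ∨ b
  y≤x∨y a b = subst (b ≤_) (∨-comm b a) (x≤x∨y b a)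

  ∨-least : ∀ {a b c} → a ≤ c → b ≤ c → a ∨ b ≤ c
  ∨-least {a} {b} {c} a≤c b≤c = begin
    (a ∨ b) ∧ c       ≡⟨ ∧-comm (a ∨ b) c ⟩
    c ∧ (a ∨ b)       ≡⟨ ∧-distrib-∨ c a b ⟩
    (c ∧ a) ∨ (c ∧ b) ≡⟨ cong₂ _∨_ (trans (∧-comm c a) a≤c) (trans (∧-comm c b) b≤c) ⟩
    a ∨ b             ∎

  x∧y≤x : ∀ a b → a ∧ b ≤ a
  x∧y≤x a b = begin
    (a ∧ b) ∧ a ≡⟨ ∧-comm (a ∧ b) a ⟩
    a ∧ (a ∧ b) ≡⟨ sym (∧-assoc a a b) ⟩
    (a ∧ a) ∧ b ≡⟨ cong (_∧ b) (∧-idem a) ⟩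
    a ∧ b       ∎

  x∧y≤y : ∀ a b → a ∧ b ≤ b
  x∧y≤y a b = subst (_≤ b) (∧-comm b a) (x∧y≤x b a)

  ∧-greatest : ∀ {a b c} → c ≤ a → c ≤ b → c ≤ a ∧ b
  ∧-greatest {a} {b} {c} c≤a c≤b = trans (sym (∧-assoc c a b)) (trans (cong (_∧ b) c≤a) c≤b)

  ∨-mono : ∀ {a b c d} → a ≤ c → b ≤ d → a ∨ b ≤ c ∨ d
  ∨-mono a≤c b≤d = ∨-least (≤-trans a≤c (x≤x∨y _ _)) (≤-trans b≤d (y≤x∨y _ _))

  ∧-mono : ∀ {a b c d} → a ≤ c → b ≤ d → a ∧ b ≤ c ∧ d
  ∧-mono a≤c b≤d = ∧-greatest (≤-trans (x∧y≤x _ _) a≤c) (≤-trans (x∧y≤y _ _) b≤d)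

  𝟎≤ : ∀ a → 𝟎 ≤ a
  𝟎≤ a = trans (cong (𝟎 ∧_) (sym (∨-identity a))) (∧-absorbs-∨ 𝟎 a)

  ≤𝟏 : ∀ a → a ≤ 𝟏
  ≤𝟏 a = trans (∧-comm a 𝟏) (∧-identity a)

  ≤𝟎⇒≡𝟎 : ∀ {a} → a ≤ 𝟎 → a ≡ 𝟎
  ≤𝟎⇒≡𝟎 a≤𝟎 = ≤-antisym a≤𝟎 (𝟎≤ _)

  ∨-identityʳ : ∀ a → a ∨ 𝟎 ≡ a
  ∨-identityʳ a = trans (∨-comm a 𝟎) (∨-identity a)

  x-y≤x : ∀ a b → a - b ≤ a
  x-y≤x a b = -least a b a (y≤x∨y b a)

  x≤y⇒x-y≡𝟎 : ∀ {a b} → a ≤ b → a - b ≡ 𝟎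
  x≤y⇒x-y≡𝟎 {a} {b} a≤b = ≤𝟎⇒≡𝟎 (-least a b 𝟎 (subst (a ≤_) (sym (∨-identityʳ b)) a≤b))

  x≤x-y⇒x-y≡x : ∀ {a b} → a ≤ a - b → a - b ≡ a
  x≤x-y⇒x-y≡x = ≤-antisym (x-y≤x _ _)

  -‿antitoneʳ : ∀ a {b b′} → b ≤ b′ → a - b′ ≤ a - b
  -‿antitoneʳ a {b} {b′} b≤b′ = -least a b′ (a - b) (≤-trans (-covers a b) (∨-mono b≤b′ ≤-refl))

  -‿monotoneˡ : ∀ {a a′} b → a ≤ a′ → a - b ≤ a′ - b
  -‿monotoneˡ {a} {a′} b a≤a′ = -least a b (a′ - b) (≤-trans a≤a′ (-covers a′ b))

  x-u≡x⇒x-v≡x : ∀ {a u v} → a - u ≡ a → v ≤ u → a - v ≡ a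
  x-u≡x⇒x-v≡x {a} a-u≡a v≤u = x≤x-y⇒x-y≡x (subst (_≤ a - _) a-u≡a (-‿antitoneʳ a v≤u))

  x-u≡x-resp-≡ : ∀ {a a′ u} → a ≡ a′ → a - u ≡ a → a′ - u ≡ a′
  x-u≡x-resp-≡ refl a-u≡a = a-u≡a

  𝟎-x≡𝟎 : ∀ b → 𝟎 - b ≡ 𝟎
  𝟎-x≡𝟎 b = x≤y⇒x-y≡𝟎 (𝟎≤ b)

  -‿distribʳ-∨ : ∀ a a′ b → (a ∨ a′) - b ≡ (a - b) ∨ (a′ - b)
  -‿distribʳ-∨ a a′ b = ≤-antisym
    (-least (a ∨ a′) b _ (∨-least (≤-trans (-covers a b) (∨-mono ≤-refl (x≤x∨y _ _)))
                                  (≤-trans (-covers a′ b) (∨-mono ≤-refl (y≤x∨y _ _)))))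
    (∨-least (-‿monotoneˡ b (x≤x∨y a a′)) (-‿monotoneˡ b (y≤x∨y a a′)))

  x-[y∨z]≡[x-y]-z : ∀ a b c → a - (b ∨ c) ≡ (a - b) - c
  x-[y∨z]≡[x-y]-z a b c = ≤-antisym
    (-least a (b ∨ c) _ (≤-trans (-covers a b)
       (≤-trans (∨-mono ≤-refl (-covers (a - b) c)) (≤-reflexive (sym (∨-assoc b c _))))))
    (-least (a - b) c _ (-least a b _ (≤-trans (-covers a (b ∨ c)) (≤-reflexive (∨-assoc b c _)))))

  x-[x∧y]≡x-y : ∀ a b → a - (a ∧ b) ≡ a - b
  x-[x∧y]≡x-y a b = ≤-antisym
    (-least a (a ∧ b) (a - b)
      (subst (_≤ (a ∧ b) ∨ (a - b)) (trans (sym (∧-distrib-∨ a b (a - b))) (-covers a b))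
        (∨-mono ≤-refl (x∧y≤y a (a - b)))))
    (-‿antitoneʳ a (x∧y≤y a b))

  record JoinPrime (p : Carrier) : Set where
    field
      nonzero : p ≢ 𝟎
      prime   : ∀ a b → p ≤ a ∨ b → p ≤ a ⊎ p ≤ b

  p≰u⇒p-u≡p : ∀ {p u} → JoinPrime p → ¬ p ≤ u → p - u ≡ p
  p≰u⇒p-u≡p {p} {u} jp p≰u with JoinPrime.prime jp u (p - u) (-covers p u)
  ... | inj₁ p≤u   = ⊥-elim (p≰u p≤u)
  ... | inj₂ p≤p-u = x≤x-y⇒x-y≡x p≤p-u

  -- In the field names, b stands for b₁ ∨ b₂.
  record Splitting (a b₁ b₂ : Carrier) : Set where
    field
      a₁ a₂       : Carrier
      a₁≢𝟎        : a₁ ≢ 𝟎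
      a₂≢𝟎        : a₂ ≢ 𝟎
      a₁∨a₂≡a     : a₁ ∨ a₂ ≡ a
      a₁∧a₂≡b₁∧b₂ : a₁ ∧ a₂ ≡ b₁ ∧ b₂
      b₁≤a₁       : b₁ ≤ a₁
      b₂≤a₂       : b₂ ≤ a₂
      a₁∧b≡b₁     : a₁ ∧ (b₁ ∨ b₂) ≡ b₁
      a₂∧b≡b₂     : a₂ ∧ (b₁ ∨ b₂) ≡ b₂
      a₁-b₁≡a₁    : a₁ - b₁ ≡ a₁
      a₂-b₂≡a₂    : a₂ - b₂ ≡ a₂
      a₁≤a        : a₁ ≤ a
      a₂≤a        : a₂ ≤ a

  opaque
    splitting : S1 L → ∀ a b₁ b₂ → (b₁ ∨ b₂) ≪ a → a ≢ 𝟎 → Splitting a b₁ b₂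
    splitting s1 a b₁ b₂ b≪a a≢𝟎 with s1 a b₁ b₂ b≪a a≢𝟎
    ... | a₁ , a₂ , a₁≢𝟎 , a₂≢𝟎 , a-a₂≡a₁ , b₁≤a₁ , a-a₁≡a₂ , b₂≤a₂ , a₁∧a₂≡b₁∧b₂ = record
      { a₁ = a₁ ; a₂ = a₂ ; a₁≢𝟎 = a₁≢𝟎 ; a₂≢𝟎 = a₂≢𝟎 ; a₁∨a₂≡a = a₁∨a₂≡a
      ; a₁∧a₂≡b₁∧b₂ = a₁∧a₂≡b₁∧b₂ ; b₁≤a₁ = b₁≤a₁ ; b₂≤a₂ = b₂≤a₂
      ; a₁∧b≡b₁ = a₁∧b≡b₁ ; a₂∧b≡b₂ = a₂∧b≡b₂
      ; a₁-b₁≡a₁ = ≤-antisym (x-y≤x a₁ b₁) (≤-trans (≤-reflexive (sym a₁-b≡a₁)) (-‿antitoneʳ a₁ (x≤x∨y b₁ b₂)))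
      ; a₂-b₂≡a₂ = ≤-antisym (x-y≤x a₂ b₂) (≤-trans (≤-reflexive (sym a₂-b≡a₂)) (-‿antitoneʳ a₂ (y≤x∨y b₁ b₂)))
      ; a₁≤a = a₁≤a ; a₂≤a = a₂≤a }
      where
      b : Carrier
      b = b₁ ∨ b₂
      a₁≤a : a₁ ≤ a
      a₁≤a = subst (_≤ a) a-a₂≡a₁ (x-y≤x a a₂)
      a₂≤a : a₂ ≤ a
      a₂≤a = subst (_≤ a) a-a₁≡a₂ (x-y≤x a a₁)
      a₁∨a₂≡a : a₁ ∨ a₂ ≡ a
      a₁∨a₂≡a = ≤-antisym (∨-least a₁≤a a₂≤a)
        (subst (a ≤_) (trans (cong (a₂ ∨_) a-a₂≡a₁) (∨-comm a₂ a₁)) (-covers a a₂))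
      a₁∧a₂≤b₁ : a₁ ∧ a₂ ≤ b₁
      a₁∧a₂≤b₁ = subst (_≤ b₁) (sym a₁∧a₂≡b₁∧b₂) (x∧y≤x b₁ b₂)
      a₁∧a₂≤b₂ : a₁ ∧ a₂ ≤ b₂
      a₁∧a₂≤b₂ = subst (_≤ b₂) (sym a₁∧a₂≡b₁∧b₂) (x∧y≤y b₁ b₂)
      a₁∧b≡b₁ : a₁ ∧ b ≡ b₁
      a₁∧b≡b₁ = ≤-antisym
        (subst (_≤ b₁) (sym (∧-distrib-∨ a₁ b₁ b₂))
          (∨-least (x∧y≤y a₁ b₁) (≤-trans (∧-mono ≤-refl b₂≤a₂) a₁∧a₂≤b₁)))
        (∧-greatest b₁≤a₁ (x≤x∨y b₁ b₂))
      a₂∧b≡b₂ : a₂ ∧ b ≡ b₂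
      a₂∧b≡b₂ = ≤-antisym
        (subst (_≤ b₂) (sym (∧-distrib-∨ a₂ b₁ b₂))
          (∨-least (≤-trans (≤-reflexive (∧-comm a₂ b₁)) (≤-trans (∧-mono b₁≤a₁ ≤-refl) a₁∧a₂≤b₂))
                   (x∧y≤y a₂ b₂)))
        (∧-greatest b₂≤a₂ (y≤x∨y b₁ b₂))
      a≡[a₁-b]∨[a₂-b] : a ≡ (a₁ - b) ∨ (a₂ - b)
      a≡[a₁-b]∨[a₂-b] = trans (sym (proj₁ b≪a)) (trans (cong (_- b) (sym a₁∨a₂≡a)) (-‿distribʳ-∨ a₁ a₂ b))
      a₁-b≡a₁ : a₁ - b ≡ a₁
      a₁-b≡a₁ = x≤x-y⇒x-y≡x (subst (_≤ a₁ - b) a-a₂≡a₁ (-least a a₂ (a₁ - b)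
        (subst (_≤ a₂ ∨ (a₁ - b)) (sym a≡[a₁-b]∨[a₂-b])
          (∨-least (y≤x∨y a₂ _) (≤-trans (x-y≤x a₂ b) (x≤x∨y a₂ _))))))
      a₂-b≡a₂ : a₂ - b ≡ a₂
      a₂-b≡a₂ = x≤x-y⇒x-y≡x (subst (_≤ a₂ - b) a-a₁≡a₂ (-least a a₁ (a₂ - b)
        (subst (_≤ a₁ ∨ (a₂ - b)) (sym a≡[a₁-b]∨[a₂-b])
          (∨-least (≤-trans (x-y≤x a₁ b) (x≤x∨y a₁ _)) (y≤x∨y a₁ _)))))

  record DensityWitness (a c b₀ : Carrier) : Set where
    field
      b       : Carrier
      b≢𝟎     : b ≢ 𝟎
      b₀≤b    : b₀ ≤ b
      b-b₀≡b  : b - b₀ ≡ b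
      b≤a     : b ≤ a
      b∧c≡b₀  : b ∧ c ≡ b₀
      a-b≡a   : a - b ≡ a

  opaque
    -- Split a along b₀ ∨ c = c into a₁ ≥ b₀ and a₂ ≥ c, then take b with b₀ ≪ b ≪ a₁ by D1.
    density : D1 L → S1 L → ∀ a c b₀ → c ≪ a → a ≢ 𝟎 → b₀ ≤ c → DensityWitness a c b₀
    density d1 s1 a c b₀ c≪a a≢𝟎 b₀≤c
      with splitting s1 a b₀ c (subst (_≪ a) (sym (x≤y⇒x∨y≡y b₀≤c)) c≪a) a≢𝟎
    ... | sp with d1 (Splitting.a₁ sp) b₀ (Splitting.a₁-b₁≡a₁ sp , Splitting.b₁≤a₁ sp) (Splitting.a₁≢𝟎 sp)
    ... | b , b≢𝟎 , (b-b₀≡b , b₀≤b) , (a₁-b≡a₁ , b≤a₁) = record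
      { b = b ; b≢𝟎 = b≢𝟎 ; b₀≤b = b₀≤b ; b-b₀≡b = b-b₀≡b ; b≤a = ≤-trans b≤a₁ a₁≤a
      ; b∧c≡b₀ = b∧c≡b₀ ; a-b≡a = a-b≡a }
      where
      open Splitting sp
      b∧c≡b₀ : b ∧ c ≡ b₀
      b∧c≡b₀ = ≤-antisym
        (subst (b ∧ c ≤_) (trans (cong (a₁ ∧_) (sym (x≤y⇒x∨y≡y b₀≤c))) a₁∧b≡b₁) (∧-mono b≤a₁ ≤-refl))
        (∧-greatest b₀≤b b₀≤c)
      a₂-b≡a₂ : a₂ - b ≡ a₂
      a₂-b≡a₂ = trans (sym (x-[x∧y]≡x-y a₂ b)) (x-u≡x⇒x-v≡x a₂-b₂≡a₂ (≤-trans (∧-mono ≤-refl b≤a₁)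
        (≤-trans (≤-reflexive (∧-comm a₂ a₁)) (subst (_≤ c) (sym a₁∧a₂≡b₁∧b₂) (x∧y≤y b₀ c)))))
      a-b≡a : a - b ≡ a
      a-b≡a = begin
        a - b                  ≡⟨ cong (_- b) (sym a₁∨a₂≡a) ⟩
        (a₁ ∨ a₂) - b          ≡⟨ -‿distribʳ-∨ a₁ a₂ b ⟩
        (a₁ - b) ∨ (a₂ - b)    ≡⟨ cong₂ _∨_ a₁-b≡a₁ a₂-b≡a₂ ⟩
        a₁ ∨ a₂                ≡⟨ a₁∨a₂≡a ⟩
        a                      ∎

module FiniteJoins (L : CoHeyting) where
  open CoHeytingProperties L

  module _ {A : Set} where
    ⋁ : List A → (A → Carrier) → Carrier
    ⋁ []       g = 𝟎
    ⋁ (r ∷ rs) g = g r ∨ ⋁ rs g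

    ⋀ : List A → (A → Carrier) → Carrier
    ⋀ []       g = 𝟏
    ⋀ (r ∷ rs) g = g r ∧ ⋀ rs g

    ⋁-least : ∀ {l g u} → (∀ {r} → r ∈ l → g r ≤ u) → ⋁ l g ≤ u
    ⋁-least {[]}    g≤u = 𝟎≤ _
    ⋁-least {r ∷ l} g≤u = ∨-least (g≤u (here refl)) (⋁-least (g≤u ∘ there))

    ⋁-upper : ∀ {l g r} → r ∈ l → g r ≤ ⋁ l g
    ⋁-upper (here refl) = x≤x∨y _ _
    ⋁-upper (there r∈l) = ≤-trans (⋁-upper r∈l) (y≤x∨y _ _)

    ⋀-lower : ∀ {l g r} → r ∈ l → ⋀ l g ≤ g r
    ⋀-lower (here refl) = x∧y≤x _ _
    ⋀-lower (there r∈l) = ≤-trans (x∧y≤y _ _) (⋀-lower r∈l)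

    ⋀-greatest : ∀ {l g u} → (∀ {r} → r ∈ l → u ≤ g r) → u ≤ ⋀ l g
    ⋀-greatest {[]}    u≤g = ≤𝟏 _
    ⋀-greatest {r ∷ l} u≤g = ∧-greatest (u≤g (here refl)) (⋀-greatest (u≤g ∘ there))

    ⋁-cong : ∀ l {g g′} → (∀ r → g r ≡ g′ r) → ⋁ l g ≡ ⋁ l g′
    ⋁-cong []      g≡g′ = refl
    ⋁-cong (r ∷ l) g≡g′ = cong₂ _∨_ (g≡g′ r) (⋁-cong l g≡g′)

    ∧-distribˡ-⋁ : ∀ a l g → a ∧ ⋁ l g ≡ ⋁ l (λ r → a ∧ g r)
    ∧-distribˡ-⋁ a []      g = ≤𝟎⇒≡𝟎 (x∧y≤y a 𝟎)
    ∧-distribˡ-⋁ a (r ∷ l) g = trans (∧-distrib-∨ a _ _) (cong (a ∧ g r ∨_) (∧-distribˡ-⋁ a l g))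

    -‿distribʳ-⋁ : ∀ l g v → ⋁ l g - v ≡ ⋁ l (λ r → g r - v)
    -‿distribʳ-⋁ []      g v = 𝟎-x≡𝟎 v
    -‿distribʳ-⋁ (r ∷ l) g v = trans (-‿distribʳ-∨ _ _ v) (cong (g r - v ∨_) (-‿distribʳ-⋁ l g v))

    joinPrime-≤⋁ : ∀ {p l g} → JoinPrime p → p ≤ ⋁ l g → Σ[ r ∈ A ] r ∈ l × p ≤ g r
    joinPrime-≤⋁ {l = []}    jp p≤𝟎 = ⊥-elim (JoinPrime.nonzero jp (≤𝟎⇒≡𝟎 p≤𝟎))
    joinPrime-≤⋁ {l = r ∷ l} jp p≤⋁ with JoinPrime.prime jp _ _ p≤⋁
    ... | inj₁ p≤gr = r , here refl , p≤gr
    ... | inj₂ p≤⋁l with joinPrime-≤⋁ {l = l} jp p≤⋁l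
    ...   | r′ , r′∈l , p≤gr′ = r′ , there r′∈l , p≤gr′

    ⋁≢𝟎 : DecidableEquality Carrier → ∀ l g → ⋁ l g ≢ 𝟎 → Σ[ r ∈ A ] r ∈ l × g r ≢ 𝟎
    ⋁≢𝟎 _≟_ []      g ⋁≢𝟎′ = ⊥-elim (⋁≢𝟎′ refl)
    ⋁≢𝟎 _≟_ (r ∷ l) g ⋁≢𝟎′ with g r ≟ 𝟎
    ... | no gr≢𝟎 = r , here refl , gr≢𝟎
    ... | yes gr≡𝟎 with ⋁≢𝟎 _≟_ l g (λ ⋁l≡𝟎 → ⋁≢𝟎′ (trans (cong₂ _∨_ gr≡𝟎 ⋁l≡𝟎) (∨-identity 𝟎)))
    ...   | r′ , r′∈l , gr′≢𝟎 = r′ , there r′∈l , gr′≢𝟎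

    select : (A → Bool) → (A → Carrier) → A → Carrier
    select φ x r = if φ r then x r else 𝟎

    select-true : ∀ {φ x r} → φ r ≡ true → select φ x r ≡ x r
    select-true {φ} {x} {r} φr = cong (λ β → if β then x r else 𝟎) φr

    select-false : ∀ {φ x r} → φ r ≡ false → select φ x r ≡ 𝟎
    select-false {φ} {x} {r} φr = cong (λ β → if β then x r else 𝟎) φr

    ⋁-select-least : ∀ {l x φ u} → (∀ {r} → r ∈ l → φ r ≡ true → x r ≤ u) → ⋁ l (select φ x) ≤ u
    ⋁-select-least {l} {x} {φ} {u} x≤u = ⋁-least term≤u
      where
      term≤u : ∀ {r} → r ∈ l → select φ x r ≤ u
      term≤u {r} r∈l with φ r in φr
      ... | true  = x≤u r∈l φr
      ... | false = 𝟎≤ u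

    ⋁-select-upper : ∀ {l x φ r} → r ∈ l → φ r ≡ true → x r ≤ ⋁ l (select φ x)
    ⋁-select-upper {x = x} {φ} r∈l φr = ≤-trans (≤-reflexive (sym (select-true {φ} {x} φr))) (⋁-upper r∈l)

    select-‿distribʳ : ∀ φ x v r → select φ x r - v ≡ select φ (λ r → x r - v) r
    select-‿distribʳ φ x v r with φ r
    ... | true  = refl
    ... | false = 𝟎-x≡𝟎 v

    joinPrime-≤⋁-select : ∀ {p l φ x} → JoinPrime p → p ≤ ⋁ l (select φ x) →
                          Σ[ r ∈ A ] r ∈ l × φ r ≡ true × p ≤ x r
    joinPrime-≤⋁-select {φ = φ} {x} jp p≤⋁ with joinPrime-≤⋁ jp p≤⋁
    ... | r , r∈l , p≤sel = bool-cases (φ r)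
      (λ φr → r , r∈l , φr , ≤-respʳ-≡ (select-true {φ} {x} φr) p≤sel)
      (λ φr → ⊥-elim (JoinPrime.nonzero jp (≤𝟎⇒≡𝟎 (≤-respʳ-≡ (select-false {φ} {x} φr) p≤sel))))

    ⋁-select≢𝟎 : DecidableEquality Carrier → ∀ l φ x → ⋁ l (select φ x) ≢ 𝟎 →
                 Σ[ r ∈ A ] r ∈ l × φ r ≡ true × x r ≢ 𝟎
    ⋁-select≢𝟎 _≟_ l φ x ⋁≢𝟎′ with ⋁≢𝟎 _≟_ l (select φ x) ⋁≢𝟎′
    ... | r , r∈l , sel≢𝟎 = bool-cases (φ r)
      (λ φr → r , r∈l , φr , sel≢𝟎 ∘ trans (select-true {φ} {x} φr))
      (λ φr → ⊥-elim (sel≢𝟎 (select-false {φ} {x} φr)))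

    ⋁-select-mono : ∀ {l x φ ψ} → (∀ {r} → r ∈ l → φ r ≡ true → ψ r ≡ true) →
                    ⋁ l (select φ x) ≤ ⋁ l (select ψ x)
    ⋁-select-mono {l} {x} {φ} {ψ} φ⇒ψ = ⋁-select-least (λ r∈l φr → ⋁-select-upper {l} {x} {ψ} r∈l (φ⇒ψ r∈l φr))

module EmbeddingProperties {A B : CoHeyting} (h : Embedding A B) where
  private
    module A = CoHeytingProperties A
    module B = CoHeytingProperties B
    module ⋁A = FiniteJoins A
    module ⋁B = FiniteJoins B
  open Embedding h using (injective; pres-𝟎; pres-𝟏; pres-∨; pres-∧)

  map-mono : ∀ {a b} → a A.≤ b → map h a B.≤ map h b
  map-mono {a} {b} a≤b = trans (sym (pres-∧ a b)) (cong (map h) a≤b)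

  map-≢𝟎 : ∀ {a} → a ≢ A.𝟎 → map h a ≢ B.𝟎
  map-≢𝟎 a≢𝟎 ha≡𝟎 = a≢𝟎 (injective _ _ (trans ha≡𝟎 (sym pres-𝟎)))

  module _ {I : Set} where
    map-⋁ : ∀ (l : List I) g → map h (⋁A.⋁ l g) ≡ ⋁B.⋁ l (map h ∘ g)
    map-⋁ []      g = pres-𝟎
    map-⋁ (r ∷ l) g = trans (pres-∨ _ _) (cong (map h (g r) B.∨_) (map-⋁ l g))

    map-⋀ : ∀ (l : List I) g → map h (⋁A.⋀ l g) ≡ ⋁B.⋀ l (map h ∘ g)
    map-⋀ []      g = pres-𝟏
    map-⋀ (r ∷ l) g = trans (pres-∧ _ _) (cong (map h (g r) B.∧_) (map-⋀ l g))

    map-select : ∀ φ x (r : I) → map h (⋁A.select φ x r) ≡ ⋁B.select φ (map h ∘ x) r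
    map-select φ x r with φ r
    ... | true  = refl
    ... | false = pres-𝟎

    map-⋁-select : ∀ (l : List I) x φ → map h (⋁A.⋁ l (⋁A.select φ x)) ≡ ⋁B.⋁ l (⋁B.select φ (map h ∘ x))
    map-⋁-select l x φ = trans (map-⋁ l (⋁A.select φ x)) (⋁B.⋁-cong l (map-select φ x))

-- The order only needs to be a partial order on the listed points.
record FinitePoset (A : Set) : Set where
  infix 7 _≤ᵇ_ _<ᵇ_
  field
    _≟_        : DecidableEquality A
    points     : List A
    _≤ᵇ_       : A → A → Bool
    ≤ᵇ-refl    : ∀ {x} → x ∈ points → x ≤ᵇ x ≡ true
    ≤ᵇ-trans   : ∀ {x y z} → x ∈ points → y ∈ points → z ∈ points →
                 x ≤ᵇ y ≡ true → y ≤ᵇ z ≡ true → x ≤ᵇ z ≡ true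
    ≤ᵇ-antisym : ∀ {x y} → x ∈ points → y ∈ points → x ≤ᵇ y ≡ true → y ≤ᵇ x ≡ true → x ≡ y

  open BooleanEquality _≟_ public

  _<ᵇ_ : A → A → Bool
  x <ᵇ y = x ≤ᵇ y && not (x == y)

  <ᵇ-intro : ∀ {x y} → x ≤ᵇ y ≡ true → x ≢ y → x <ᵇ y ≡ true
  <ᵇ-intro x≤y x≢y = &&-intro x≤y (cong not (≢⇒==false x≢y))

  <ᵇ⇒≤ᵇ : ∀ {x y} → x <ᵇ y ≡ true → x ≤ᵇ y ≡ true
  <ᵇ⇒≤ᵇ {x} {y} = ∧-conicalˡ (x ≤ᵇ y) _

  <ᵇ⇒≢ : ∀ {x y} → x <ᵇ y ≡ true → x ≢ y
  <ᵇ⇒≢ {x} {y} x<y = ==false⇒≢ (not-injective (∧-conicalʳ (x ≤ᵇ y) _ x<y))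

  DownClosed : (A → Bool) → Set
  DownClosed S = ∀ {r r′} → r ∈ points → r′ ∈ points → S r ≡ true → r′ ≤ᵇ r ≡ true → S r′ ≡ true

record IsPMorphism {A B : Set} (Q : FinitePoset A) (P : FinitePoset B) (f : A → B) : Set where
  private
    module Q = FinitePoset Q
    module P = FinitePoset P
  field
    f-∈        : ∀ {q} → q ∈ Q.points → f q ∈ P.points
    monotone   : ∀ {p q} → p ∈ Q.points → q ∈ Q.points → p Q.≤ᵇ q ≡ true → f p P.≤ᵇ f q ≡ true
    lift       : ∀ {p s} → p ∈ Q.points → s ∈ P.points → f p P.≤ᵇ s ≡ true →
                 Σ[ q ∈ A ] q ∈ Q.points × p Q.≤ᵇ q ≡ true × f q ≡ s
    surjective : ∀ {s} → s ∈ P.points → Σ[ q ∈ A ] q ∈ Q.points × f q ≡ s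

module Realisations (L : CoHeyting) where
  open CoHeytingProperties L
  open FiniteJoins L

  module _ {A : Set} where
    infix 9 ⋁[_]_∣_
    ⋁[_]_∣_ : FinitePoset A → (A → Carrier) → (A → Bool) → Carrier
    ⋁[ Q ] x ∣ φ = ⋁ (FinitePoset.points Q) (select φ x)

    module _ (Q : FinitePoset A) where
      open FinitePoset Q

      ⋁∣-least : ∀ {x u} φ → (∀ {r} → r ∈ points → φ r ≡ true → x r ≤ u) → ⋁[ Q ] x ∣ φ ≤ u
      ⋁∣-least φ = ⋁-select-least

      ⋁∣-upper : ∀ {x r} φ → r ∈ points → φ r ≡ true → x r ≤ ⋁[ Q ] x ∣ φ
      ⋁∣-upper {x} φ = ⋁-select-upper {x = x} {φ}

      ⋁∣-mono : ∀ {x} φ ψ → (∀ {r} → r ∈ points → φ r ≡ true → ψ r ≡ true) → ⋁[ Q ] x ∣ φ ≤ ⋁[ Q ] x ∣ ψ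
      ⋁∣-mono {x} φ ψ = ⋁-select-mono {x = x} {φ} {ψ}

      meet-≤-self : ∀ {x p} → p ∈ points → x p ∧ x p ≤ ⋁[ Q ] x ∣ (λ r → r ≤ᵇ p && r ≤ᵇ p)
      meet-≤-self {x} {p} p∈Q = ≤-trans (x∧y≤x _ _)
        (⋁∣-upper {x} (λ r → r ≤ᵇ p && r ≤ᵇ p) p∈Q (&&-intro (≤ᵇ-refl p∈Q) (≤ᵇ-refl p∈Q)))

      meet-≤-swap : ∀ {x p q} → x q ∧ x p ≤ ⋁[ Q ] x ∣ (λ r → r ≤ᵇ q && r ≤ᵇ p) →
                    x p ∧ x q ≤ ⋁[ Q ] x ∣ (λ r → r ≤ᵇ p && r ≤ᵇ q)
      meet-≤-swap {x} {p} {q} h = subst (_≤ ⋁[ Q ] x ∣ (λ r → r ≤ᵇ p && r ≤ᵇ q)) (∧-comm _ _)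
        (≤-trans h (⋁∣-mono _ _ (λ {r} _ → trans (&&-comm (r ≤ᵇ p) (r ≤ᵇ q)))))

      -- x p plays the role of the image of the principal down-set of p under an embedding of the
      -- algebra of down-sets of Q; the four conditions characterise such embeddings.
      record IsRealisation (x : A → Carrier) : Set where
        field
          monotone       : ∀ {p q} → p ∈ points → q ∈ points → p ≤ᵇ q ≡ true → x p ≤ x q
          meet-≤         : ∀ {p q} → p ∈ points → q ∈ points →
                           x p ∧ x q ≤ ⋁[ Q ] x ∣ (λ r → r ≤ᵇ p && r ≤ᵇ q)
          disjoint-below : ∀ {p} → p ∈ points → x p - ⋁[ Q ] x ∣ (_<ᵇ p) ≡ x p
          nonzero        : ∀ {p} → p ∈ points → x p ≢ 𝟎

      module _ {x : A → Carrier} (R : IsRealisation x) where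
        open IsRealisation R

        meet-⋁-downClosed : ∀ {p} S → p ∈ points → DownClosed S →
                            x p ∧ ⋁[ Q ] x ∣ S ≤ ⋁[ Q ] x ∣ (λ r → r ≤ᵇ p && S r)
        meet-⋁-downClosed {p} S p∈Q S↓ =
          ≤-trans (≤-reflexive (∧-distribˡ-⋁ (x p) points (select S x))) (⋁-least term≤)
          where
          term≤ : ∀ {r} → r ∈ points → x p ∧ select S x r ≤ ⋁[ Q ] x ∣ (λ r → r ≤ᵇ p && S r)
          term≤ {r} r∈Q with S r in Sr
          ... | false = ≤-trans (x∧y≤y _ _) (𝟎≤ _)
          ... | true  = ≤-trans (meet-≤ p∈Q r∈Q) (⋁∣-mono _ (λ r → r ≤ᵇ p && S r)
                          (λ {r′} r′∈Q h → &&-intro (∧-conicalˡ (r′ ≤ᵇ p) _ h) (S↓ r∈Q r′∈Q Sr (∧-conicalʳ (r′ ≤ᵇ p) _ h))))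

        ⋁-meet-⋁-downClosed : ∀ S T → DownClosed S → DownClosed T →
                              ⋁[ Q ] x ∣ S ∧ ⋁[ Q ] x ∣ T ≤ ⋁[ Q ] x ∣ (λ r → S r && T r)
        ⋁-meet-⋁-downClosed S T S↓ T↓ =
          ≤-trans (≤-reflexive (trans (∧-comm _ _) (∧-distribˡ-⋁ (⋁[ Q ] x ∣ T) points (select S x)))) (⋁-least term≤)
          where
          term≤ : ∀ {r} → r ∈ points → ⋁[ Q ] x ∣ T ∧ select S x r ≤ ⋁[ Q ] x ∣ (λ r → S r && T r)
          term≤ {r} r∈Q with S r in Sr
          ... | false = ≤-trans (x∧y≤y _ _) (𝟎≤ _)
          ... | true  = ≤-trans (≤-reflexive (∧-comm _ _)) (≤-trans (meet-⋁-downClosed T r∈Q T↓)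
                          (⋁∣-mono _ (λ r → S r && T r)
                            (λ {r′} r′∈Q h → &&-intro (S↓ r∈Q r′∈Q Sr (∧-conicalˡ (r′ ≤ᵇ r) _ h)) (∧-conicalʳ (r′ ≤ᵇ r) _ h))))

-- t is deleted, and z inherits everything below t.
module Collapse {A : Set} (Q : FinitePoset A) (t z : A) where
  open FinitePoset Q

  record IsCollapsible : Set where
    field
      t∈Q     : t ∈ points
      z∈Q     : z ∈ points
      t≢z     : t ≢ z
      above-t : ∀ {y} → y ∈ points → t ≤ᵇ y ≡ true → y ≢ t → z ≤ᵇ y ≡ true
      above-z : ∀ {y} → y ∈ points → z ≤ᵇ y ≡ true → y ≢ z → t ≤ᵇ y ≡ true
      z≰t     : z ≤ᵇ t ≡ false

  points′ : List A
  points′ = filterᵇ (λ s → not (s == t)) points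

  infix 7 _≤′_
  _≤′_ : A → A → Bool
  r ≤′ y = r ≤ᵇ y || (y == z && r ≤ᵇ t)

  ∈′⇒∈ : ∀ {r} → r ∈ points′ → r ∈ points
  ∈′⇒∈ r∈Q′ = proj₁ (∈-filter-≢ {l = points} r∈Q′)

  ∈′⇒≢t : ∀ {r} → r ∈ points′ → r ≢ t
  ∈′⇒≢t r∈Q′ = proj₂ (∈-filter-≢ {l = points} r∈Q′)

  ∈⇒∈′ : ∀ {r} → r ∈ points → r ≢ t → r ∈ points′
  ∈⇒∈′ = ≢-∈-filter

  ≤ᵇ⇒≤′ : ∀ {r y} → r ≤ᵇ y ≡ true → r ≤′ y ≡ true
  ≤ᵇ⇒≤′ = ||-introˡ _

  ≤t⇒≤′z : ∀ {r} → r ≤ᵇ t ≡ true → r ≤′ z ≡ true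
  ≤t⇒≤′z {r} r≤t = ||-introʳ (r ≤ᵇ z) (&&-intro (≡⇒== refl) r≤t)

  ≤′-cases : ∀ {r y} → r ≤′ y ≡ true → r ≤ᵇ y ≡ true ⊎ (y ≡ z × r ≤ᵇ t ≡ true)
  ≤′-cases {r} {y} r≤′y with ||-elim {r ≤ᵇ y} r≤′y
  ... | inj₁ r≤y = inj₁ r≤y
  ... | inj₂ h   = inj₂ (==⇒≡ (∧-conicalˡ (y == z) _ h) , ∧-conicalʳ (y == z) _ h)

  ≤′⇒≤ᵇ : ∀ {r y} → y ≢ z → r ≤′ y ≡ true → r ≤ᵇ y ≡ true
  ≤′⇒≤ᵇ y≢z r≤′y with ≤′-cases r≤′y
  ... | inj₁ r≤y        = r≤y
  ... | inj₂ (y≡z , _) = ⊥-elim (y≢z y≡z)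

  length-points′ : t ∈ points → length points′ <ℕ length points
  length-points′ t∈Q = filter-notAll (T? ∘ (λ s → not (s == t))) points
    (Any.map (λ { refl → λ T[t≠t] → ≡true⇒≢false (Equivalence.to T-≡ T[t≠t]) (cong not (≡⇒== refl)) }) t∈Q)

  module Collapsed (c : IsCollapsible) where
    open IsCollapsible c

    z∈Q′ : z ∈ points′
    z∈Q′ = ∈⇒∈′ z∈Q (t≢z ∘ sym)

    ≤′-trans : ∀ {x y w} → x ∈ points′ → y ∈ points′ → w ∈ points′ →
               x ≤′ y ≡ true → y ≤′ w ≡ true → x ≤′ w ≡ true
    ≤′-trans {x} {y} {w} x∈ y∈ w∈ x≤y y≤w with ≤′-cases x≤y | ≤′-cases y≤w
    ... | inj₁ x≤y′        | inj₁ y≤w′        = ≤ᵇ⇒≤′ (≤ᵇ-trans (∈′⇒∈ x∈) (∈′⇒∈ y∈) (∈′⇒∈ w∈) x≤y′ y≤w′)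
    ... | inj₁ x≤y′        | inj₂ (refl , y≤t) = ≤t⇒≤′z (≤ᵇ-trans (∈′⇒∈ x∈) (∈′⇒∈ y∈) t∈Q x≤y′ y≤t)
    ... | inj₂ (refl , x≤t) | inj₁ z≤w with w ≟ z
    ...   | yes refl = ||-introʳ (x ≤ᵇ w) x≤t
    ...   | no w≢z   = ||-introˡ _ (≤ᵇ-trans (∈′⇒∈ x∈) t∈Q (∈′⇒∈ w∈) x≤t (above-z (∈′⇒∈ w∈) z≤w w≢z))
    ≤′-trans _ _ _ _ _ | inj₂ (refl , x≤t) | inj₂ (refl , _) = ≤t⇒≤′z x≤t

    ≤′-antisym : ∀ {x y} → x ∈ points′ → y ∈ points′ → x ≤′ y ≡ true → y ≤′ x ≡ true → x ≡ y
    ≤′-antisym {x} {y} x∈ y∈ x≤y y≤x with ≤′-cases x≤y | ≤′-cases y≤x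
    ... | inj₁ x≤y′        | inj₁ y≤x′        = ≤ᵇ-antisym (∈′⇒∈ x∈) (∈′⇒∈ y∈) x≤y′ y≤x′
    ... | inj₁ z≤y         | inj₂ (refl , y≤t) = ⊥-elim (≡true⇒≢false (≤ᵇ-trans z∈Q (∈′⇒∈ y∈) t∈Q z≤y y≤t) z≰t)
    ... | inj₂ (refl , x≤t) | inj₁ z≤x        = ⊥-elim (≡true⇒≢false (≤ᵇ-trans z∈Q (∈′⇒∈ x∈) t∈Q z≤x x≤t) z≰t)
    ... | inj₂ (y≡z , _)   | inj₂ (x≡z , _)   = trans x≡z (sym y≡z)

    Q′ : FinitePoset A
    Q′ = record
      { _≟_ = _≟_ ; points = points′ ; _≤ᵇ_ = _≤′_
      ; ≤ᵇ-refl = ≤ᵇ⇒≤′ ∘ ≤ᵇ-refl ∘ ∈′⇒∈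
      ; ≤ᵇ-trans = ≤′-trans ; ≤ᵇ-antisym = ≤′-antisym }

    ≤t⇒≢z : ∀ {r} → r ≤ᵇ t ≡ true → r ≢ z
    ≤t⇒≢z r≤t refl = ≡true⇒≢false r≤t z≰t

    <t-downClosed : FinitePoset.DownClosed Q′ (_<ᵇ t)
    <t-downClosed r∈Q′ r′∈Q′ r<t r′≤r = <ᵇ-intro
      (≤ᵇ-trans (∈′⇒∈ r′∈Q′) (∈′⇒∈ r∈Q′) t∈Q (≤′⇒≤ᵇ (≤t⇒≢z (<ᵇ⇒≤ᵇ r<t)) r′≤r) (<ᵇ⇒≤ᵇ r<t)) (∈′⇒≢t r′∈Q′)

    collapse-pMorphism : ∀ {B} {P : FinitePoset B} {f : A → B} →
                         IsPMorphism Q P f → f t ≡ f z → IsPMorphism Q′ P f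
    collapse-pMorphism {P = P} {f} fᴾ ft≡fz = record
      { f-∈ = f-∈ ∘ ∈′⇒∈ ; monotone = monotone′ ; lift = lift′ ; surjective = surjective′ }
      where
      open IsPMorphism fᴾ
      open FinitePoset P using () renaming (_≤ᵇ_ to _≤ᴾ_)
      monotone′ : ∀ {p q} → p ∈ points′ → q ∈ points′ → p ≤′ q ≡ true → f p ≤ᴾ f q ≡ true
      monotone′ {p} p∈ q∈ p≤q with ≤′-cases p≤q
      ... | inj₁ p≤q′        = monotone (∈′⇒∈ p∈) (∈′⇒∈ q∈) p≤q′
      ... | inj₂ (refl , p≤t) = subst (λ s → f p ≤ᴾ s ≡ true) ft≡fz (monotone (∈′⇒∈ p∈) t∈Q p≤t)
      lift′ : ∀ {p s} → p ∈ points′ → s ∈ FinitePoset.points P → f p ≤ᴾ s ≡ true →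
              Σ[ q ∈ A ] q ∈ points′ × p ≤′ q ≡ true × f q ≡ s
      lift′ p∈ s∈ fp≤s with lift (∈′⇒∈ p∈) s∈ fp≤s
      ... | q , q∈ , p≤q , fq≡s with q ≟ t
      ...   | yes refl = z , z∈Q′ , ≤t⇒≤′z p≤q , trans (sym ft≡fz) fq≡s
      ...   | no q≢t   = q , ∈⇒∈′ q∈ q≢t , ≤ᵇ⇒≤′ p≤q , fq≡s
      surjective′ : ∀ {s} → s ∈ FinitePoset.points P → Σ[ q ∈ A ] q ∈ points′ × f q ≡ s
      surjective′ s∈ with surjective s∈
      ... | q , q∈ , fq≡s with q ≟ t
      ...   | yes refl = z , z∈Q′ , trans (sym ft≡fz) fq≡s
      ...   | no q≢t   = q , ∈⇒∈′ q∈ q≢t , fq≡s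

module Refinement (L : CoHeyting) {A : Set} (Q : FinitePoset A) {t z : A}
                  (coll : Collapse.IsCollapsible Q t z) where
  open CoHeytingProperties L
  open Realisations L
  open FinitePoset Q
  open Collapse Q t z
  open IsCollapsible coll
  open Collapsed coll

  Refines : (A → Carrier) → (A → Carrier) → Set
  Refines x x′ = ∀ φ → φ t ≡ φ z → ⋁[ Q ] x ∣ φ ≡ ⋁[ Q′ ] x′ ∣ φ

  refines : ∀ {x x′} → (∀ {r} → r ≢ t → r ≢ z → x r ≡ x′ r) → x t ∨ x z ≡ x′ z → Refines x x′
  refines {x} {x′} x≡x′ xt∨xz≡x′z φ φt≡φz = ≤-antisym (⋁∣-least Q φ x≤) (⋁∣-least Q′ φ x′≤)
    where
    xt∨xz≤ : φ z ≡ true → x t ∨ x z ≤ ⋁[ Q′ ] x′ ∣ φ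
    xt∨xz≤ φz = ≤-respˡ-≡ (sym xt∨xz≡x′z) (⋁∣-upper Q′ φ z∈Q′ φz)
    x≤ : ∀ {r} → r ∈ points → φ r ≡ true → x r ≤ ⋁[ Q′ ] x′ ∣ φ
    x≤ {r} r∈Q φr with r ≟ t | r ≟ z
    ... | yes refl | _        = ≤-trans (x≤x∨y _ _) (xt∨xz≤ (trans (sym φt≡φz) φr))
    ... | no _     | yes refl = ≤-trans (y≤x∨y _ _) (xt∨xz≤ φr)
    ... | no r≢t   | no r≢z   = ≤-respˡ-≡ (sym (x≡x′ r≢t r≢z)) (⋁∣-upper Q′ φ (∈⇒∈′ r∈Q r≢t) φr)
    x′≤ : ∀ {r} → r ∈ points′ → φ r ≡ true → x′ r ≤ ⋁[ Q ] x ∣ φ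
    x′≤ {r} r∈Q′ φr with r ≟ z
    ... | yes refl = ≤-respˡ-≡ xt∨xz≡x′z
                       (∨-least (⋁∣-upper Q φ t∈Q (trans φt≡φz φr)) (⋁∣-upper Q φ z∈Q φr))
    ... | no r≢z   = ≤-respˡ-≡ (x≡x′ (∈′⇒≢t r∈Q′) r≢z) (⋁∣-upper Q φ (∈′⇒∈ r∈Q′) φr)

-- t lies below z: t becomes a new element b with b₀ ≪ b ≤ x′ z, where b₀ joins what lies strictly below t.
module DensityStep (L : CoHeyting) (d1 : D1 L) (s1 : S1 L) {A : Set} (Q : FinitePoset A) {t z : A}
                   (coll : Collapse.IsCollapsible Q t z) (t≤z : FinitePoset._≤ᵇ_ Q t z ≡ true) where
  open CoHeytingProperties L
  open Realisations L
  open FinitePoset Q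
  open Collapse Q t z
  open IsCollapsible coll
  open Collapsed coll
  open Refinement L Q coll
  private
    module Q′ = FinitePoset Q′

  ≤′⇒≤ᵇ-t≤z : ∀ {r y} → r ∈ points → r ≤′ y ≡ true → r ≤ᵇ y ≡ true
  ≤′⇒≤ᵇ-t≤z r∈Q r≤′y with ≤′-cases r≤′y
  ... | inj₁ r≤y        = r≤y
  ... | inj₂ (refl , r≤t) = ≤ᵇ-trans r∈Q t∈Q z∈Q r≤t t≤z

  module _ {x′ : A → Carrier} (R′ : IsRealisation Q′ x′) where
    private
      module R′ = IsRealisation R′

    a c b₀ : Carrier
    a  = x′ z
    c  = ⋁[ Q′ ] x′ ∣ (Q′._<ᵇ z)
    b₀ = ⋁[ Q′ ] x′ ∣ (_<ᵇ t)

    c≪a : c ≪ a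
    c≪a = R′.disjoint-below z∈Q′ , ⋁∣-least Q′ _ (λ r∈Q′ r<z → R′.monotone r∈Q′ z∈Q′ (Q′.<ᵇ⇒≤ᵇ r<z))

    b₀≤c : b₀ ≤ c
    b₀≤c = ⋁∣-mono Q′ _ _ λ r∈Q′ r<t →
      Q′.<ᵇ-intro (≤t⇒≤′z (<ᵇ⇒≤ᵇ r<t)) (≤t⇒≢z (<ᵇ⇒≤ᵇ r<t))

    open DensityWitness (density d1 s1 a c b₀ c≪a (R′.nonzero z∈Q′) b₀≤c)

    opaque
      x : A → Carrier
      x y = if y == t then b else x′ y

      x-t : x t ≡ b
      x-t = cong (λ β → if β then b else x′ t) (≡⇒== refl)

      x-≢t : ∀ {y} → y ≢ t → x y ≡ x′ y
      x-≢t {y} y≢t = cong (λ β → if β then b else x′ y) (≢⇒==false y≢t)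

    x-≡t : ∀ {y} → y ≡ t → x y ≡ b
    x-≡t y≡t = trans (cong x y≡t) x-t

    x′≤⋁ : ∀ φ {r} → r ∈ points′ → φ r ≡ true → x′ r ≤ ⋁[ Q ] x ∣ φ
    x′≤⋁ φ r∈Q′ φr = ≤-respˡ-≡ (x-≢t (∈′⇒≢t r∈Q′)) (⋁∣-upper Q φ (∈′⇒∈ r∈Q′) φr)

    b≤⋁ : ∀ φ → φ t ≡ true → b ≤ ⋁[ Q ] x ∣ φ
    b≤⋁ φ φt = ≤-respˡ-≡ x-t (⋁∣-upper Q φ t∈Q φt)

    monotone : ∀ {p q} → p ∈ points → q ∈ points → p ≤ᵇ q ≡ true → x p ≤ x q
    monotone {p} {q} p∈Q q∈Q p≤q with p ≟ t | q ≟ t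
    ... | yes refl | yes refl = ≤-refl
    ... | yes refl | no q≢t   = subst₂ _≤_ (sym x-t) (sym (x-≢t q≢t))
      (≤-trans b≤a (R′.monotone z∈Q′ (∈⇒∈′ q∈Q q≢t) (≤ᵇ⇒≤′ (above-t q∈Q p≤q q≢t))))
    ... | no p≢t   | yes refl = subst₂ _≤_ (sym (x-≢t p≢t)) (sym x-t)
      (≤-trans (⋁∣-upper Q′ (_<ᵇ t) (∈⇒∈′ p∈Q p≢t) (<ᵇ-intro p≤q p≢t)) b₀≤b)
    ... | no p≢t   | no q≢t   = subst₂ _≤_ (sym (x-≢t p≢t)) (sym (x-≢t q≢t))
      (R′.monotone (∈⇒∈′ p∈Q p≢t) (∈⇒∈′ q∈Q q≢t) (≤ᵇ⇒≤′ p≤q))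

    -- When t ≰ q, the part of b below x′ q lies below c, hence below b ∧ c = b₀.
    b∧x′≤b₀ : ∀ {q} → q ∈ points → q ≢ t → t ≤ᵇ q ≡ false → b ∧ x′ q ≤ b₀
    b∧x′≤b₀ {q} q∈Q q≢t t≰q = ≤-respʳ-≡ b∧c≡b₀ (∧-greatest (x∧y≤x _ _) b∧x′q≤c)
      where
      r≤′z,q⇒r≢z : ∀ {r} → (r ≤′ z && r ≤′ q) ≡ true → r ≢ z
      r≤′z,q⇒r≢z {r} h r≡z = ≡true⇒≢false (≤ᵇ-trans t∈Q z∈Q q∈Q t≤z
        (≤′⇒≤ᵇ-t≤z z∈Q (subst (λ v → v ≤′ q ≡ true) r≡z (∧-conicalʳ (r ≤′ z) _ h)))) t≰q
      b∧x′q≤c : b ∧ x′ q ≤ c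
      b∧x′q≤c = ≤-trans (∧-mono b≤a ≤-refl) (≤-trans (R′.meet-≤ z∈Q′ (∈⇒∈′ q∈Q q≢t))
        (⋁∣-mono Q′ _ _ λ {r} _ h → Q′.<ᵇ-intro (∧-conicalˡ (r ≤′ z) _ h) (r≤′z,q⇒r≢z h)))

    b∧x′≤ : ∀ {q} → q ∈ points → q ≢ t → b ∧ x′ q ≤ ⋁[ Q ] x ∣ (λ r → r ≤ᵇ t && r ≤ᵇ q)
    b∧x′≤ {q} q∈Q q≢t = bool-cases (t ≤ᵇ q)
      (λ t≤q → ≤-trans (x∧y≤x _ _) (b≤⋁ _ (&&-intro (≤ᵇ-refl t∈Q) t≤q)))
      (λ t≰q → ≤-trans (∧-greatest (x∧y≤y _ _) (b∧x′≤b₀ q∈Q q≢t t≰q))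
        (≤-trans (meet-⋁-downClosed Q′ R′ (_<ᵇ t) (∈⇒∈′ q∈Q q≢t) <t-downClosed)
          (⋁∣-least Q′ _ λ {r} r∈Q′ h →
            x′≤⋁ _ r∈Q′ (&&-intro (<ᵇ⇒≤ᵇ (∧-conicalʳ (r ≤′ q) _ h))
                                  (≤′⇒≤ᵇ-t≤z (∈′⇒∈ r∈Q′) (∧-conicalˡ (r ≤′ q) _ h))))))

    meet-≤ : ∀ {p q} → p ∈ points → q ∈ points → x p ∧ x q ≤ ⋁[ Q ] x ∣ (λ r → r ≤ᵇ p && r ≤ᵇ q)
    meet-≤ {p} {q} p∈Q q∈Q with p ≟ t | q ≟ t
    ... | yes refl | yes refl = meet-≤-self Q p∈Q
    ... | yes refl | no q≢t   = ≤-respˡ-≡ (cong₂ _∧_ (sym x-t) (sym (x-≢t q≢t))) (b∧x′≤ q∈Q q≢t)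
    ... | no p≢t   | yes refl = meet-≤-swap Q
      (≤-respˡ-≡ (cong₂ _∧_ (sym x-t) (sym (x-≢t p≢t))) (b∧x′≤ p∈Q p≢t))
    ... | no p≢t   | no q≢t   = ≤-respˡ-≡ (cong₂ _∧_ (sym (x-≢t p≢t)) (sym (x-≢t q≢t)))
      (≤-trans (R′.meet-≤ (∈⇒∈′ p∈Q p≢t) (∈⇒∈′ q∈Q q≢t)) (⋁∣-least Q′ _ λ {r} r∈Q′ h →
        x′≤⋁ _ r∈Q′ (&&-intro (≤′⇒≤ᵇ-t≤z (∈′⇒∈ r∈Q′) (∧-conicalˡ (r ≤′ p) _ h))
                              (≤′⇒≤ᵇ-t≤z (∈′⇒∈ r∈Q′) (∧-conicalʳ (r ≤′ p) _ h)))))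

    b-⋁<t≡b : b - ⋁[ Q ] x ∣ (_<ᵇ t) ≡ b
    b-⋁<t≡b = x-u≡x⇒x-v≡x b-b₀≡b (⋁∣-least Q _ λ r∈Q r<t →
      subst (_≤ b₀) (sym (x-≢t (<ᵇ⇒≢ r<t))) (⋁∣-upper Q′ (_<ᵇ t) (∈⇒∈′ r∈Q (<ᵇ⇒≢ r<t)) r<t))

    a-⋁<z≡a : a - ⋁[ Q ] x ∣ (_<ᵇ z) ≡ a
    a-⋁<z≡a = x-u≡x⇒x-v≡x a-[c∨b]≡a (⋁∣-least Q _ ≤c∨b)
      where
      a-[c∨b]≡a : a - (c ∨ b) ≡ a
      a-[c∨b]≡a = trans (x-[y∨z]≡[x-y]-z a c b) (trans (cong (_- b) (proj₁ c≪a)) a-b≡a)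
      ≤c∨b : ∀ {r} → r ∈ points → r <ᵇ z ≡ true → x r ≤ c ∨ b
      ≤c∨b {r} r∈Q r<z with r ≟ t
      ... | yes r≡t = ≤-respˡ-≡ (sym (x-≡t r≡t)) (y≤x∨y c b)
      ... | no r≢t   = ≤-respˡ-≡ (sym (x-≢t r≢t)) (≤-trans
        (⋁∣-upper Q′ (Q′._<ᵇ z) (∈⇒∈′ r∈Q r≢t) (Q′.<ᵇ-intro (≤ᵇ⇒≤′ (<ᵇ⇒≤ᵇ r<z)) (<ᵇ⇒≢ r<z))) (x≤x∨y c b))

    x′-⋁<≡x′ : ∀ {p} → p ∈ points → p ≢ t → p ≢ z → x′ p - ⋁[ Q ] x ∣ (_<ᵇ p) ≡ x′ p
    x′-⋁<≡x′ {p} p∈Q p≢t p≢z = x-u≡x⇒x-v≡x (R′.disjoint-below (∈⇒∈′ p∈Q p≢t)) (⋁∣-least Q _ ≤⋁′)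
      where
      ≤⋁′ : ∀ {r} → r ∈ points → r <ᵇ p ≡ true → x r ≤ ⋁[ Q′ ] x′ ∣ (Q′._<ᵇ p)
      ≤⋁′ {r} r∈Q r<p with r ≟ t
      ... | yes r≡t = ≤-respˡ-≡ (sym (x-≡t r≡t)) (≤-trans b≤a (⋁∣-upper Q′ (Q′._<ᵇ p) z∈Q′
        (Q′.<ᵇ-intro (≤ᵇ⇒≤′ (above-t p∈Q (subst (λ v → v ≤ᵇ p ≡ true) r≡t (<ᵇ⇒≤ᵇ r<p)) p≢t)) (p≢z ∘ sym))))
      ... | no r≢t   = ≤-respˡ-≡ (sym (x-≢t r≢t))
        (⋁∣-upper Q′ (Q′._<ᵇ p) (∈⇒∈′ r∈Q r≢t) (Q′.<ᵇ-intro (≤ᵇ⇒≤′ (<ᵇ⇒≤ᵇ r<p)) (<ᵇ⇒≢ r<p)))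

    disjoint-below : ∀ {p} → p ∈ points → x p - ⋁[ Q ] x ∣ (_<ᵇ p) ≡ x p
    disjoint-below {p} p∈Q with p ≟ t | p ≟ z
    ... | yes refl | _        = x-u≡x-resp-≡ (sym x-t) b-⋁<t≡b
    ... | no p≢t   | yes refl = x-u≡x-resp-≡ (sym (x-≢t p≢t)) a-⋁<z≡a
    ... | no p≢t   | no p≢z   = x-u≡x-resp-≡ (sym (x-≢t p≢t)) (x′-⋁<≡x′ p∈Q p≢t p≢z)

    nonzero : ∀ {p} → p ∈ points → x p ≢ 𝟎
    nonzero {p} p∈Q with p ≟ t
    ... | yes refl = b≢𝟎 ∘ trans (sym x-t)
    ... | no p≢t   = R′.nonzero (∈⇒∈′ p∈Q p≢t) ∘ trans (sym (x-≢t p≢t))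

    density-step : Σ[ y ∈ (A → Carrier) ] IsRealisation Q y × Refines y x′
    density-step = x
      , record { monotone = monotone ; meet-≤ = meet-≤ ; disjoint-below = disjoint-below ; nonzero = nonzero }
      , refines (λ r≢t _ → x-≢t r≢t) (trans (cong₂ _∨_ x-t (x-≢t (t≢z ∘ sym))) (x≤y⇒x∨y≡y b≤a))

-- t and z are incomparable: x′ z splits into a₁ (the new value at z) and a₂ (the value at t),
-- separated along what lies strictly below z and strictly below t.
module SplittingStep (L : CoHeyting) (s1 : S1 L) {A : Set} (Q : FinitePoset A) {t z : A}
                     (coll : Collapse.IsCollapsible Q t z) (t≰z : FinitePoset._≤ᵇ_ Q t z ≡ false) where
  open CoHeytingProperties L
  open Realisations L
  open FinitePoset Q
  open Collapse Q t z
  open IsCollapsible coll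
  open Collapsed coll
  open Refinement L Q coll
  private
    module Q′ = FinitePoset Q′

  <z-downClosed : Q′.DownClosed (_<ᵇ z)
  <z-downClosed {r} {r′} r∈Q′ r′∈Q′ r<z r′≤r = <ᵇ-intro r′≤z r′≢z
    where
    r′≤z = ≤ᵇ-trans (∈′⇒∈ r′∈Q′) (∈′⇒∈ r∈Q′) z∈Q (≤′⇒≤ᵇ (<ᵇ⇒≢ r<z) r′≤r) (<ᵇ⇒≤ᵇ r<z)
    r′≢z : r′ ≢ z
    r′≢z r′≡z = <ᵇ⇒≢ r<z (≤ᵇ-antisym (∈′⇒∈ r∈Q′) z∈Q (<ᵇ⇒≤ᵇ r<z)
      (subst (λ v → v ≤ᵇ r ≡ true) r′≡z (≤′⇒≤ᵇ (<ᵇ⇒≢ r<z) r′≤r)))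

  module _ {x′ : A → Carrier} (R′ : IsRealisation Q′ x′) where
    private
      module R′ = IsRealisation R′

    a b₁ b₂ c : Carrier
    a  = x′ z
    b₁ = ⋁[ Q′ ] x′ ∣ (_<ᵇ z)
    b₂ = ⋁[ Q′ ] x′ ∣ (_<ᵇ t)
    c  = ⋁[ Q′ ] x′ ∣ (Q′._<ᵇ z)

    b₁≤c : b₁ ≤ c
    b₁≤c = ⋁∣-mono Q′ _ _ λ r∈Q′ r<z → Q′.<ᵇ-intro (≤ᵇ⇒≤′ (<ᵇ⇒≤ᵇ r<z)) (<ᵇ⇒≢ r<z)

    b₂≤c : b₂ ≤ c
    b₂≤c = ⋁∣-mono Q′ _ _ λ r∈Q′ r<t → Q′.<ᵇ-intro (≤t⇒≤′z (<ᵇ⇒≤ᵇ r<t)) (≤t⇒≢z (<ᵇ⇒≤ᵇ r<t))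

    c≤b₁∨b₂ : c ≤ b₁ ∨ b₂
    c≤b₁∨b₂ = ⋁∣-least Q′ _ ≤b₁∨b₂
      where
      ≤b₁∨b₂ : ∀ {r} → r ∈ points′ → r Q′.<ᵇ z ≡ true → x′ r ≤ b₁ ∨ b₂
      ≤b₁∨b₂ {r} r∈Q′ r<′z with ≤′-cases (Q′.<ᵇ⇒≤ᵇ r<′z)
      ... | inj₁ r≤z       = ≤-trans (⋁∣-upper Q′ (_<ᵇ z) r∈Q′ (<ᵇ-intro r≤z (Q′.<ᵇ⇒≢ r<′z))) (x≤x∨y _ _)
      ... | inj₂ (_ , r≤t) = ≤-trans (⋁∣-upper Q′ (_<ᵇ t) r∈Q′ (<ᵇ-intro r≤t (∈′⇒≢t r∈Q′))) (y≤x∨y _ _)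

    b₁∨b₂≪a : (b₁ ∨ b₂) ≪ a
    b₁∨b₂≪a = x-u≡x⇒x-v≡x (R′.disjoint-below z∈Q′) (∨-least b₁≤c b₂≤c)
            , ≤-trans (∨-least b₁≤c b₂≤c) (⋁∣-least Q′ _ λ r∈Q′ r<z → R′.monotone r∈Q′ z∈Q′ (Q′.<ᵇ⇒≤ᵇ r<z))

    open Splitting (splitting s1 a b₁ b₂ b₁∨b₂≪a (R′.nonzero z∈Q′))

    opaque
      x : A → Carrier
      x y = if y == t then a₂ else if y == z then a₁ else x′ y

      x-t : x t ≡ a₂
      x-t = cong (λ β → if β then a₂ else if t == z then a₁ else x′ t) (≡⇒== refl)

      x-z : x z ≡ a₁
      x-z = trans (cong (λ β → if β then a₂ else if z == z then a₁ else x′ z) (≢⇒==false (t≢z ∘ sym)))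
                  (cong (λ β → if β then a₁ else x′ z) (≡⇒== refl))

      x-other : ∀ {y} → y ≢ t → y ≢ z → x y ≡ x′ y
      x-other {y} y≢t y≢z = trans (cong (λ β → if β then a₂ else if y == z then a₁ else x′ y) (≢⇒==false y≢t))
                                  (cong (λ β → if β then a₁ else x′ y) (≢⇒==false y≢z))

    x′≤⋁ : ∀ φ {r} → r ∈ points′ → r ≢ z → φ r ≡ true → x′ r ≤ ⋁[ Q ] x ∣ φ
    x′≤⋁ φ r∈Q′ r≢z φr = ≤-respˡ-≡ (x-other (∈′⇒≢t r∈Q′) r≢z) (⋁∣-upper Q φ (∈′⇒∈ r∈Q′) φr)

    a≤⋁ : ∀ φ → φ z ≡ true → φ t ≡ true → a ≤ ⋁[ Q ] x ∣ φ
    a≤⋁ φ φz φt = ≤-respˡ-≡ a₁∨a₂≡a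
      (∨-least (≤-respˡ-≡ x-z (⋁∣-upper Q φ z∈Q φz)) (≤-respˡ-≡ x-t (⋁∣-upper Q φ t∈Q φt)))

    monotone : ∀ {p q} → p ∈ points → q ∈ points → p ≤ᵇ q ≡ true → x p ≤ x q
    monotone {p} {q} p∈Q q∈Q p≤q with p ≟ t | p ≟ z | q ≟ t | q ≟ z
    ... | yes refl | _ | yes refl | _ = ≤-refl
    ... | yes refl | _ | no _ | yes refl = ⊥-elim (≡true⇒≢false p≤q t≰z)
    ... | yes refl | _ | no q≢t | no q≢z = ≤-respˡ-≡ (sym x-t) (≤-respʳ-≡ (sym (x-other q≢t q≢z))
      (≤-trans a₂≤a (R′.monotone z∈Q′ (∈⇒∈′ q∈Q q≢t) (≤ᵇ⇒≤′ (above-t q∈Q p≤q q≢t)))))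
    ... | no _ | yes refl | yes refl | _ = ⊥-elim (≡true⇒≢false p≤q z≰t)
    ... | no _ | yes refl | no _ | yes refl = ≤-refl
    ... | no _ | yes refl | no q≢t | no q≢z = ≤-respˡ-≡ (sym x-z) (≤-respʳ-≡ (sym (x-other q≢t q≢z))
      (≤-trans a₁≤a (R′.monotone z∈Q′ (∈⇒∈′ q∈Q q≢t) (≤ᵇ⇒≤′ p≤q))))
    ... | no p≢t | no p≢z | yes refl | _ = ≤-respˡ-≡ (sym (x-other p≢t p≢z)) (≤-respʳ-≡ (sym x-t)
      (≤-trans (⋁∣-upper Q′ (_<ᵇ t) (∈⇒∈′ p∈Q p≢t) (<ᵇ-intro p≤q p≢t)) b₂≤a₂))
    ... | no p≢t | no p≢z | no _ | yes refl = ≤-respˡ-≡ (sym (x-other p≢t p≢z)) (≤-respʳ-≡ (sym x-z)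
      (≤-trans (⋁∣-upper Q′ (_<ᵇ z) (∈⇒∈′ p∈Q p≢t) (<ᵇ-intro p≤q p≢z)) b₁≤a₁))
    ... | no p≢t | no p≢z | no q≢t | no q≢z = ≤-respˡ-≡ (sym (x-other p≢t p≢z)) (≤-respʳ-≡ (sym (x-other q≢t q≢z))
      (R′.monotone (∈⇒∈′ p∈Q p≢t) (∈⇒∈′ q∈Q q≢t) (≤ᵇ⇒≤′ p≤q)))

    z≰q⇒a∧x′≤c : ∀ {q} → q ∈ points → q ≢ t → q ≢ z → z ≤ᵇ q ≡ false → a ∧ x′ q ≤ c
    z≰q⇒a∧x′≤c {q} q∈Q q≢t q≢z z≰q = ≤-trans (R′.meet-≤ z∈Q′ (∈⇒∈′ q∈Q q≢t))
      (⋁∣-mono Q′ _ _ λ {r} _ h → Q′.<ᵇ-intro (∧-conicalˡ (r ≤′ z) _ h) λ r≡z →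
        ≡true⇒≢false (≤′⇒≤ᵇ q≢z (subst (λ v → v ≤′ q ≡ true) r≡z (∧-conicalʳ (r ≤′ z) _ h))) z≰q)

    x′∧⋁<≤ : ∀ {s q} → q ∈ points → q ≢ t → q ≢ z → Q′.DownClosed (_<ᵇ s) → (∀ {r} → r <ᵇ s ≡ true → r ≢ z) →
             x′ q ∧ ⋁[ Q′ ] x′ ∣ (_<ᵇ s) ≤ ⋁[ Q ] x ∣ (λ r → r ≤ᵇ s && r ≤ᵇ q)
    x′∧⋁<≤ {s} {q} q∈Q q≢t q≢z <s-downClosed <s⇒≢z =
      ≤-trans (meet-⋁-downClosed Q′ R′ (_<ᵇ s) (∈⇒∈′ q∈Q q≢t) <s-downClosed)
        (⋁∣-least Q′ _ λ {r} r∈Q′ h → x′≤⋁ _ r∈Q′ (<s⇒≢z (∧-conicalʳ (r ≤′ q) _ h))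
          (&&-intro (<ᵇ⇒≤ᵇ (∧-conicalʳ (r ≤′ q) _ h)) (≤′⇒≤ᵇ q≢z (∧-conicalˡ (r ≤′ q) _ h))))

    a₁∧x′≤ : ∀ {q} → q ∈ points → q ≢ t → q ≢ z → a₁ ∧ x′ q ≤ ⋁[ Q ] x ∣ (λ r → r ≤ᵇ z && r ≤ᵇ q)
    a₁∧x′≤ {q} q∈Q q≢t q≢z = bool-cases (z ≤ᵇ q)
      (λ z≤q → ≤-trans (x∧y≤x _ _) (≤-respˡ-≡ x-z (⋁∣-upper Q (λ r → r ≤ᵇ z && r ≤ᵇ q) z∈Q (&&-intro (≤ᵇ-refl z∈Q) z≤q))))
      (λ z≰q → ≤-trans (∧-greatest (x∧y≤y _ _) (≤-respʳ-≡ a₁∧b≡b₁ (∧-greatest (x∧y≤x _ _)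
                 (≤-trans (∧-mono a₁≤a ≤-refl) (≤-trans (z≰q⇒a∧x′≤c q∈Q q≢t q≢z z≰q) c≤b₁∨b₂)))))
               (x′∧⋁<≤ q∈Q q≢t q≢z <z-downClosed <ᵇ⇒≢))

    a₂∧x′≤ : ∀ {q} → q ∈ points → q ≢ t → q ≢ z → a₂ ∧ x′ q ≤ ⋁[ Q ] x ∣ (λ r → r ≤ᵇ t && r ≤ᵇ q)
    a₂∧x′≤ {q} q∈Q q≢t q≢z = bool-cases (t ≤ᵇ q)
      (λ t≤q → ≤-trans (x∧y≤x _ _) (≤-respˡ-≡ x-t (⋁∣-upper Q (λ r → r ≤ᵇ t && r ≤ᵇ q) t∈Q (&&-intro (≤ᵇ-refl t∈Q) t≤q))))
      (λ t≰q → ≤-trans (∧-greatest (x∧y≤y _ _) (≤-respʳ-≡ a₂∧b≡b₂ (∧-greatest (x∧y≤x _ _)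
                 (≤-trans (∧-mono a₂≤a ≤-refl) (≤-trans (z≰q⇒a∧x′≤c q∈Q q≢t q≢z (z≰q t≰q)) c≤b₁∨b₂)))))
               (x′∧⋁<≤ q∈Q q≢t q≢z <t-downClosed (≤t⇒≢z ∘ <ᵇ⇒≤ᵇ)))
      where
      z≰q : t ≤ᵇ q ≡ false → z ≤ᵇ q ≡ false
      z≰q t≰q = bool-cases (z ≤ᵇ q) (λ z≤q → ⊥-elim (≡true⇒≢false (above-z q∈Q z≤q q≢z) t≰q)) (λ z≰q → z≰q)

    a₁∧a₂≤ : a₁ ∧ a₂ ≤ ⋁[ Q ] x ∣ (λ r → r ≤ᵇ z && r ≤ᵇ t)
    a₁∧a₂≤ = ≤-respˡ-≡ (sym a₁∧a₂≡b₁∧b₂) (≤-trans (⋁-meet-⋁-downClosed Q′ R′ _ _ <z-downClosed <t-downClosed)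
      (⋁∣-least Q′ _ λ {r} r∈Q′ h → x′≤⋁ _ r∈Q′ (<ᵇ⇒≢ (∧-conicalˡ (r <ᵇ z) _ h))
        (&&-intro (<ᵇ⇒≤ᵇ (∧-conicalˡ (r <ᵇ z) _ h)) (<ᵇ⇒≤ᵇ (∧-conicalʳ (r <ᵇ z) _ h)))))

    x′∧x′≤ : ∀ {p q} → p ∈ points → q ∈ points → p ≢ t → p ≢ z → q ≢ t → q ≢ z →
             x′ p ∧ x′ q ≤ ⋁[ Q ] x ∣ (λ r → r ≤ᵇ p && r ≤ᵇ q)
    x′∧x′≤ {p} {q} p∈Q q∈Q p≢t p≢z q≢t q≢z =
      ≤-trans (R′.meet-≤ (∈⇒∈′ p∈Q p≢t) (∈⇒∈′ q∈Q q≢t)) (⋁∣-least Q′ _ x′≤)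
      where
      x′≤ : ∀ {r} → r ∈ points′ → (r ≤′ p && r ≤′ q) ≡ true → x′ r ≤ ⋁[ Q ] x ∣ (λ r → r ≤ᵇ p && r ≤ᵇ q)
      x′≤ {r} r∈Q′ h with r ≟ z
      ... | yes refl = a≤⋁ _ (&&-intro z≤p z≤q) (&&-intro (above-z p∈Q z≤p p≢z) (above-z q∈Q z≤q q≢z))
        where
        z≤p = ≤′⇒≤ᵇ p≢z (∧-conicalˡ (r ≤′ p) _ h)
        z≤q = ≤′⇒≤ᵇ q≢z (∧-conicalʳ (r ≤′ p) _ h)
      ... | no r≢z   = x′≤⋁ _ r∈Q′ r≢z
        (&&-intro (≤′⇒≤ᵇ p≢z (∧-conicalˡ (r ≤′ p) _ h)) (≤′⇒≤ᵇ q≢z (∧-conicalʳ (r ≤′ p) _ h)))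

    meet-≤ : ∀ {p q} → p ∈ points → q ∈ points → x p ∧ x q ≤ ⋁[ Q ] x ∣ (λ r → r ≤ᵇ p && r ≤ᵇ q)
    meet-≤ {p} {q} p∈Q q∈Q with p ≟ t | p ≟ z | q ≟ t | q ≟ z
    ... | yes refl | _ | yes refl | _ = meet-≤-self Q p∈Q
    ... | yes refl | _ | no _ | yes refl = meet-≤-swap Q (≤-respˡ-≡ (sym (cong₂ _∧_ x-z x-t)) a₁∧a₂≤)
    ... | yes refl | _ | no q≢t | no q≢z = ≤-respˡ-≡ (sym (cong₂ _∧_ x-t (x-other q≢t q≢z))) (a₂∧x′≤ q∈Q q≢t q≢z)
    ... | no _ | yes refl | yes refl | _ = ≤-respˡ-≡ (sym (cong₂ _∧_ x-z x-t)) a₁∧a₂≤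
    ... | no _ | yes refl | no _ | yes refl = meet-≤-self Q p∈Q
    ... | no _ | yes refl | no q≢t | no q≢z = ≤-respˡ-≡ (sym (cong₂ _∧_ x-z (x-other q≢t q≢z))) (a₁∧x′≤ q∈Q q≢t q≢z)
    ... | no p≢t | no p≢z | yes refl | _ =
      meet-≤-swap Q (≤-respˡ-≡ (sym (cong₂ _∧_ x-t (x-other p≢t p≢z))) (a₂∧x′≤ p∈Q p≢t p≢z))
    ... | no p≢t | no p≢z | no _ | yes refl =
      meet-≤-swap Q (≤-respˡ-≡ (sym (cong₂ _∧_ x-z (x-other p≢t p≢z))) (a₁∧x′≤ p∈Q p≢t p≢z))
    ... | no p≢t | no p≢z | no q≢t | no q≢z =
      ≤-respˡ-≡ (sym (cong₂ _∧_ (x-other p≢t p≢z) (x-other q≢t q≢z))) (x′∧x′≤ p∈Q q∈Q p≢t p≢z q≢t q≢z)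

    ⋁<t≤b₂ : ⋁[ Q ] x ∣ (_<ᵇ t) ≤ b₂
    ⋁<t≤b₂ = ⋁∣-least Q _ λ r∈Q r<t → ≤-respˡ-≡ (sym (x-other (<ᵇ⇒≢ r<t) (≤t⇒≢z (<ᵇ⇒≤ᵇ r<t))))
      (⋁∣-upper Q′ (_<ᵇ t) (∈⇒∈′ r∈Q (<ᵇ⇒≢ r<t)) r<t)

    ⋁<z≤b₁ : ⋁[ Q ] x ∣ (_<ᵇ z) ≤ b₁
    ⋁<z≤b₁ = ⋁∣-least Q _ λ r∈Q r<z → ≤-respˡ-≡ (sym (x-other (r≢t r<z) (<ᵇ⇒≢ r<z)))
      (⋁∣-upper Q′ (_<ᵇ z) (∈⇒∈′ r∈Q (r≢t r<z)) r<z)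
      where
      r≢t : ∀ {r} → r <ᵇ z ≡ true → r ≢ t
      r≢t r<z refl = ≡true⇒≢false (<ᵇ⇒≤ᵇ r<z) t≰z

    ⋁<≤⋁′< : ∀ {p} → p ∈ points → p ≢ t → p ≢ z → ⋁[ Q ] x ∣ (_<ᵇ p) ≤ ⋁[ Q′ ] x′ ∣ (Q′._<ᵇ p)
    ⋁<≤⋁′< {p} p∈Q p≢t p≢z = ⋁∣-least Q _ ≤⋁′
      where
      a≤⋁′ : z ≤ᵇ p ≡ true → a ≤ ⋁[ Q′ ] x′ ∣ (Q′._<ᵇ p)
      a≤⋁′ z≤p = ⋁∣-upper Q′ (Q′._<ᵇ p) z∈Q′ (Q′.<ᵇ-intro (≤ᵇ⇒≤′ z≤p) (p≢z ∘ sym))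
      ≤⋁′ : ∀ {r} → r ∈ points → r <ᵇ p ≡ true → x r ≤ ⋁[ Q′ ] x′ ∣ (Q′._<ᵇ p)
      ≤⋁′ {r} r∈Q r<p with r ≟ t | r ≟ z
      ... | yes refl | _ = ≤-respˡ-≡ (sym x-t) (≤-trans a₂≤a (a≤⋁′ (above-t p∈Q (<ᵇ⇒≤ᵇ r<p) p≢t)))
      ... | no _ | yes refl = ≤-respˡ-≡ (sym x-z) (≤-trans a₁≤a (a≤⋁′ (<ᵇ⇒≤ᵇ r<p)))
      ... | no r≢t | no r≢z = ≤-respˡ-≡ (sym (x-other r≢t r≢z))
        (⋁∣-upper Q′ (Q′._<ᵇ p) (∈⇒∈′ r∈Q r≢t) (Q′.<ᵇ-intro (≤ᵇ⇒≤′ (<ᵇ⇒≤ᵇ r<p)) (<ᵇ⇒≢ r<p)))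

    disjoint-below : ∀ {p} → p ∈ points → x p - ⋁[ Q ] x ∣ (_<ᵇ p) ≡ x p
    disjoint-below {p} p∈Q with p ≟ t | p ≟ z
    ... | yes refl | _ = x-u≡x-resp-≡ (sym x-t) (x-u≡x⇒x-v≡x a₂-b₂≡a₂ ⋁<t≤b₂)
    ... | no _ | yes refl = x-u≡x-resp-≡ (sym x-z) (x-u≡x⇒x-v≡x a₁-b₁≡a₁ ⋁<z≤b₁)
    ... | no p≢t | no p≢z = x-u≡x-resp-≡ (sym (x-other p≢t p≢z))
      (x-u≡x⇒x-v≡x (R′.disjoint-below (∈⇒∈′ p∈Q p≢t)) (⋁<≤⋁′< p∈Q p≢t p≢z))

    nonzero : ∀ {p} → p ∈ points → x p ≢ 𝟎
    nonzero {p} p∈Q with p ≟ t | p ≟ z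
    ... | yes refl | _ = a₂≢𝟎 ∘ trans (sym x-t)
    ... | no _ | yes refl = a₁≢𝟎 ∘ trans (sym x-z)
    ... | no p≢t | no p≢z = R′.nonzero (∈⇒∈′ p∈Q p≢t) ∘ trans (sym (x-other p≢t p≢z))

    splitting-step : Σ[ y ∈ (A → Carrier) ] IsRealisation Q y × Refines y x′
    splitting-step = x
      , record { monotone = monotone ; meet-≤ = meet-≤ ; disjoint-below = disjoint-below ; nonzero = nonzero }
      , refines x-other (trans (cong₂ _∨_ x-t x-z) (trans (∨-comm a₂ a₁) a₁∨a₂≡a))

module FinitePosetProperties {A : Set} (Q : FinitePoset A) where
  open FinitePoset Q

  maximal : ∀ {P : A → Set} → Decidable P → ∀ {l} → (∀ {a} → a ∈ l → a ∈ points) → Any P l →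
            Σ[ m ∈ A ] m ∈ l × P m × (∀ {y} → y ∈ l → P y → m ≤ᵇ y ≡ true → y ≡ m)
  maximal {P} P? {a ∷ l} l⊆Q ∃P with any? P? l
  ... | no ¬∃P = a , here refl , Pa ∃P , a-max
    where
    Pa : Any P (a ∷ l) → P a
    Pa (here Pa′) = Pa′
    Pa (there ∃P′) = ⊥-elim (¬∃P ∃P′)
    a-max : ∀ {y} → y ∈ a ∷ l → P y → a ≤ᵇ y ≡ true → y ≡ a
    a-max (here y≡a) _  _ = y≡a
    a-max (there y∈l) Py _ = ⊥-elim (¬∃P (lose y∈l Py))
  ... | yes ∃P′ with maximal P? (l⊆Q ∘ there) ∃P′
  ...   | m , m∈l , Pm , m-max with P? a ×-dec (m ≤ᵇ a ≟ᵇ true) ×-dec ¬? (a ≟ m)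
  ...     | yes (Pa , m≤a , a≢m) = a , here refl , Pa , a-max
    where
    a-max : ∀ {y} → y ∈ a ∷ l → P y → a ≤ᵇ y ≡ true → y ≡ a
    a-max (here y≡a) _ _ = y≡a
    a-max (there y∈l) Py a≤y = ⊥-elim (a≢m (≤ᵇ-antisym (l⊆Q (here refl)) (l⊆Q (there m∈l))
      (subst (λ v → a ≤ᵇ v ≡ true) y≡m a≤y) m≤a))
      where
      y≡m = m-max y∈l Py (≤ᵇ-trans (l⊆Q (there m∈l)) (l⊆Q (here refl)) (l⊆Q (there y∈l)) m≤a a≤y)
  ...     | no ¬[Pa,m≤a,a≢m] = m , there m∈l , Pm , m-max′
    where
    m-max′ : ∀ {y} → y ∈ a ∷ l → P y → m ≤ᵇ y ≡ true → y ≡ m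
    m-max′ (there y∈l) = m-max y∈l
    m-max′ (here refl) Pa m≤a with a ≟ m
    ... | yes a≡m = a≡m
    ... | no a≢m  = ⊥-elim (¬[Pa,m≤a,a≢m] (Pa , m≤a , a≢m))

record CollapsiblePair {A B : Set} (Q : FinitePoset A) (f : A → B) : Set where
  field
    t z           : A
    isCollapsible : Collapse.IsCollapsible Q t z
    ft≡fz         : f t ≡ f z

-- Take z maximal among the points sharing their image with another point, and then t maximal
-- among the other points of the fibre of z; the lifting property of f makes (t , z) collapsible.
module _ {A B : Set} {Q : FinitePoset A} {P : FinitePoset B} {f : A → B} (fᴾ : IsPMorphism Q P f) where
  open FinitePoset Q
  open FinitePoset P using () renaming (_≟_ to _≟ᴾ_; _≤ᵇ_ to _≤ᴾ_)
  open FinitePosetProperties Q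
  open IsPMorphism fᴾ

  private
    SharedWith : A → A → Set
    SharedWith q q′ = q′ ≢ q × f q′ ≡ f q

    sharedWith? : ∀ q → Decidable (SharedWith q)
    sharedWith? q q′ = ¬? (q′ ≟ q) ×-dec (f q′ ≟ᴾ f q)

    Shared : A → Set
    Shared q = Any (SharedWith q) points

    shared? : Decidable Shared
    shared? q = any? (sharedWith? q) points

  injective-or-collapsible : (∀ {q q′} → q ∈ points → q′ ∈ points → f q ≡ f q′ → q ≡ q′) ⊎ CollapsiblePair Q f
  injective-or-collapsible with any? shared? points
  ... | no ¬shared = inj₁ injective
    where
    injective : ∀ {q q′} → q ∈ points → q′ ∈ points → f q ≡ f q′ → q ≡ q′
    injective {q} {q′} q∈Q q′∈Q fq≡fq′ with q ≟ q′
    ... | yes q≡q′ = q≡q′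
    ... | no q≢q′  = ⊥-elim (¬shared (lose q′∈Q (lose q∈Q (q≢q′ , fq≡fq′))))
  ... | yes someShared = inj₂ (record { t = t ; z = z ; ft≡fz = ft≡fz ; isCollapsible = record
    { t∈Q = t∈Q ; z∈Q = z∈Q ; t≢z = t≢z ; above-t = above-t ; above-z = above-z ; z≰t = z≰t } })
    where
    z-max = maximal shared? (λ q∈Q → q∈Q) someShared
    z = proj₁ z-max
    z∈Q = proj₁ (proj₂ z-max)
    z-maximal : ∀ {y} → y ∈ points → Shared y → z ≤ᵇ y ≡ true → y ≡ z
    z-maximal = proj₂ (proj₂ (proj₂ z-max))
    t-max = maximal (sharedWith? z) (λ r∈Q → r∈Q) (proj₁ (proj₂ (proj₂ z-max)))
    t = proj₁ t-max
    t∈Q = proj₁ (proj₂ t-max)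
    t≢z = proj₁ (proj₁ (proj₂ (proj₂ t-max)))
    ft≡fz = proj₂ (proj₁ (proj₂ (proj₂ t-max)))
    t-maximal : ∀ {y} → y ∈ points → SharedWith z y → t ≤ᵇ y ≡ true → y ≡ t
    t-maximal = proj₂ (proj₂ (proj₂ t-max))
    shared : ∀ {y y′} → y′ ∈ points → y′ ≢ y → f y′ ≡ f y → Shared y
    shared y′∈Q y′≢y fy′≡fy = lose y′∈Q (y′≢y , fy′≡fy)
    z≰t : z ≤ᵇ t ≡ false
    z≰t = bool-cases (z ≤ᵇ t) (λ z≤t → ⊥-elim (t≢z (z-maximal t∈Q (shared z∈Q (t≢z ∘ sym) (sym ft≡fz)) z≤t)))
                              (λ z≰t → z≰t)
    above-z : ∀ {y} → y ∈ points → z ≤ᵇ y ≡ true → y ≢ z → t ≤ᵇ y ≡ true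
    above-z {y} y∈Q z≤y y≢z
      with lift t∈Q (f-∈ y∈Q) (subst (λ v → v ≤ᴾ f y ≡ true) (sym ft≡fz) (monotone z∈Q y∈Q z≤y))
    ... | y′ , y′∈Q , t≤y′ , fy′≡fy with y′ ≟ y
    ...   | yes refl = t≤y′
    ...   | no y′≢y  = ⊥-elim (y≢z (z-maximal y∈Q (shared y′∈Q y′≢y fy′≡fy) z≤y))
    above-t : ∀ {y} → y ∈ points → t ≤ᵇ y ≡ true → y ≢ t → z ≤ᵇ y ≡ true
    above-t {y} y∈Q t≤y y≢t with y ≟ z
    ... | yes refl = ≤ᵇ-refl z∈Q
    ... | no y≢z with f y ≟ᴾ f z
    ...   | yes fy≡fz = ⊥-elim (y≢t (t-maximal y∈Q (y≢z , fy≡fz) t≤y))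
    ...   | no fy≢fz with lift z∈Q (f-∈ y∈Q) (subst (λ v → v ≤ᴾ f y ≡ true) ft≡fz (monotone t∈Q y∈Q t≤y))
    ...     | y′ , y′∈Q , z≤y′ , fy′≡fy with y′ ≟ y
    ...       | yes refl = z≤y′
    ...       | no y′≢y  = ⊥-elim (fy≢fz (trans (sym fy′≡fy)
                  (cong f (z-maximal y′∈Q (shared y∈Q (y′≢y ∘ sym) (sym fy′≡fy)) z≤y′))))

module Lifting (L : CoHeyting) where
  open CoHeytingProperties L
  open Realisations L

  Commutes : ∀ {A B} → FinitePoset A → FinitePoset B → (A → B) → (B → Carrier) → (A → Carrier) → Set
  Commutes Q P f X x = ∀ {s} → s ∈ FinitePoset.points P → X s ≡ ⋁[ Q ] x ∣ (λ q → FinitePoset._≤ᵇ_ P (f q) s)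

  module _ {A B : Set} {Q : FinitePoset A} {P : FinitePoset B} {f : A → B} (fᴾ : IsPMorphism Q P f)
           (f-injective : ∀ {q q′} → q ∈ FinitePoset.points Q → q′ ∈ FinitePoset.points Q → f q ≡ f q′ → q ≡ q′)
           {X : B → Carrier} (RX : IsRealisation P X) where
    private
      module P = FinitePoset P
      module RX = IsRealisation RX
    open FinitePoset Q
    open IsPMorphism fᴾ

    reflects-≤ : ∀ {r p} → r ∈ points → p ∈ points → f r P.≤ᵇ f p ≡ true → r ≤ᵇ p ≡ true
    reflects-≤ {r} r∈Q p∈Q fr≤fp with lift r∈Q (f-∈ p∈Q) fr≤fp
    ... | r′ , r′∈Q , r≤r′ , fr′≡fp = subst (λ v → r ≤ᵇ v ≡ true) (f-injective r′∈Q p∈Q fr′≡fp) r≤r′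

    pullback-meet-≤ : ∀ {p q} → p ∈ points → q ∈ points →
                      X (f p) ∧ X (f q) ≤ ⋁[ Q ] (X ∘ f) ∣ (λ r → r ≤ᵇ p && r ≤ᵇ q)
    pullback-meet-≤ {p} {q} p∈Q q∈Q = ≤-trans (RX.meet-≤ (f-∈ p∈Q) (f-∈ q∈Q)) (⋁∣-least P _ X≤)
      where
      X≤ : ∀ {s} → s ∈ P.points → (s P.≤ᵇ f p && s P.≤ᵇ f q) ≡ true → X s ≤ ⋁[ Q ] (X ∘ f) ∣ (λ r → r ≤ᵇ p && r ≤ᵇ q)
      X≤ {s} s∈P h with surjective s∈P
      ... | r , r∈Q , refl = ⋁∣-upper Q (λ r → r ≤ᵇ p && r ≤ᵇ q) r∈Q
        (&&-intro (reflects-≤ r∈Q p∈Q (∧-conicalˡ (f r P.≤ᵇ f p) _ h)) (reflects-≤ r∈Q q∈Q (∧-conicalʳ (f r P.≤ᵇ f p) _ h)))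

    pullback-disjoint-below : ∀ {p} → p ∈ points → X (f p) - ⋁[ Q ] (X ∘ f) ∣ (_<ᵇ p) ≡ X (f p)
    pullback-disjoint-below {p} p∈Q = x-u≡x⇒x-v≡x (RX.disjoint-below (f-∈ p∈Q)) (⋁∣-least Q _ λ r∈Q r<p →
      ⋁∣-upper P (P._<ᵇ f p) (f-∈ r∈Q) (P.<ᵇ-intro (monotone r∈Q p∈Q (<ᵇ⇒≤ᵇ r<p)) (<ᵇ⇒≢ r<p ∘ f-injective r∈Q p∈Q)))

    pullback-commutes : Commutes Q P f X (X ∘ f)
    pullback-commutes {s} s∈P with surjective s∈P
    ... | r , r∈Q , refl = ≤-antisym
      (⋁∣-upper Q (λ q → f q P.≤ᵇ f r) r∈Q (P.≤ᵇ-refl (f-∈ r∈Q)))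
      (⋁∣-least Q _ λ q∈Q fq≤fr → RX.monotone (f-∈ q∈Q) (f-∈ r∈Q) fq≤fr)

    pullback-realisation : IsRealisation Q (X ∘ f) × Commutes Q P f X (X ∘ f)
    pullback-realisation = record
      { monotone = λ p∈Q q∈Q p≤q → RX.monotone (f-∈ p∈Q) (f-∈ q∈Q) (monotone p∈Q q∈Q p≤q)
      ; meet-≤ = pullback-meet-≤ ; disjoint-below = pullback-disjoint-below ; nonzero = RX.nonzero ∘ f-∈ }
      , pullback-commutes

  -- n bounds the number of points of Q, which drops when t is collapsed onto z.
  lift-realisation : D1 L → S1 L → ∀ n {A B} {Q : FinitePoset A} {P : FinitePoset B} {f : A → B} →
                     length (FinitePoset.points Q) <ℕ n → IsPMorphism Q P f → ∀ {X} → IsRealisation P X →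
                     Σ[ x ∈ (A → Carrier) ] IsRealisation Q x × Commutes Q P f X x
  lift-realisation d1 s1 (suc n) {A} {Q = Q} {P} {f} (s≤s |Q|≤n) fᴾ {X} RX with injective-or-collapsible fᴾ
  ... | inj₁ f-injective = X ∘ f , pullback-realisation fᴾ f-injective RX
  ... | inj₂ pair = proj₁ step , proj₁ (proj₂ step) , commutes
    where
    open FinitePoset Q using (_≤ᵇ_)
    open FinitePoset P using () renaming (_≤ᵇ_ to _≤ᴾ_)
    open CollapsiblePair pair
    open Collapse Q t z using (length-points′; module Collapsed)
    open Collapsed isCollapsible
    open Refinement L Q isCollapsible using (Refines)
    collapsed : Σ[ x′ ∈ (A → Carrier) ] IsRealisation Q′ x′ × Commutes Q′ P f X x′
    collapsed = lift-realisation d1 s1 n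
      (ℕ.<-≤-trans (length-points′ (Collapse.IsCollapsible.t∈Q isCollapsible)) |Q|≤n)
      (collapse-pMorphism fᴾ ft≡fz) RX
    step : Σ[ x ∈ (A → Carrier) ] IsRealisation Q x × Refines x (proj₁ collapsed)
    step = bool-cases (t ≤ᵇ z)
      (λ t≤z → DensityStep.density-step L d1 s1 Q isCollapsible t≤z (proj₁ (proj₂ collapsed)))
      (λ t≰z → SplittingStep.splitting-step L s1 Q isCollapsible t≰z (proj₁ (proj₂ collapsed)))
    commutes : Commutes Q P f X (proj₁ step)
    commutes {s} s∈P = trans (proj₂ (proj₂ collapsed) s∈P)
      (sym (proj₂ (proj₂ step) (λ q → f q ≤ᴾ s) (cong (_≤ᴾ s) ft≡fz)))

module _ {A : Set} {P Q : A → Set} (P? : Decidable P) (Q? : Decidable Q) where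
  length-filter-mono : ∀ xs → (∀ {x} → x ∈ xs → P x → Q x) → length (filter P? xs) ≤ℕ length (filter Q? xs)
  length-filter-mono []       P⇒Q = z≤n
  length-filter-mono (x ∷ xs) P⇒Q with P? x | Q? x
  ... | yes _  | yes _  = s≤s (length-filter-mono xs (P⇒Q ∘ there))
  ... | yes px | no ¬qx = ⊥-elim (¬qx (P⇒Q (here refl) px))
  ... | no _   | yes _  = ℕ.m≤n⇒m≤1+n (length-filter-mono xs (P⇒Q ∘ there))
  ... | no _   | no _   = length-filter-mono xs (P⇒Q ∘ there)

  length-filter-< : ∀ xs → (∀ {x} → x ∈ xs → P x → Q x) → Any (λ x → Q x × ¬ P x) xs →
                    length (filter P? xs) <ℕ length (filter Q? xs)
  length-filter-< (x ∷ xs) P⇒Q witness with P? x | Q? x | witness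
  ... | yes px | no ¬qx | _                = ⊥-elim (¬qx (P⇒Q (here refl) px))
  ... | yes px | _      | here (_ , ¬px)   = ⊥-elim (¬px px)
  ... | no _   | no ¬qx | here (qx , _)    = ⊥-elim (¬qx qx)
  ... | no _   | yes _  | here _           = s≤s (length-filter-mono xs (P⇒Q ∘ there))
  ... | yes _  | yes _  | there witness′   = s≤s (length-filter-< xs (P⇒Q ∘ there) witness′)
  ... | no _   | yes _  | there witness′   = ℕ.m≤n⇒m≤1+n (length-filter-< xs (P⇒Q ∘ there) witness′)
  ... | no _   | no _   | there witness′   = length-filter-< xs (P⇒Q ∘ there) witness′

module FiniteCoHeyting (K : CoHeyting) (fin : Finite K) where
  open CoHeytingProperties K
  open FiniteJoins K
  open Realisations K
  open Inverse (proj₂ fin)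

  opaque
    infix 4 _≟_
    _≟_ : DecidableEquality Carrier
    x ≟ y = map′ (λ e → trans (sym (inverseʳ refl)) (trans (cong from e) (inverseʳ refl))) (cong to) (to x ≟ᶠ to y)

  elements : List Carrier
  elements = mapᴸ from (allFin (proj₁ fin))

  ∈-elements : ∀ x → x ∈ elements
  ∈-elements x = subst (_∈ elements) (inverseʳ refl) (∈-map⁺ from (∈-allFin (to x)))

  infix 4 _≤?_
  _≤?_ : ∀ x y → Dec (x ≤ y)
  x ≤? y = x ∧ y ≟ x

  infix 7 _≤ᵇ_
  _≤ᵇ_ : Carrier → Carrier → Bool
  x ≤ᵇ y = does (x ≤? y)

  ≤ᵇ⇒≤ : ∀ {x y} → x ≤ᵇ y ≡ true → x ≤ y
  ≤ᵇ⇒≤ {x} {y} x≤y with x ≤? y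
  ... | yes x≤y′ = x≤y′

  ≤⇒≤ᵇ : ∀ {x y} → x ≤ y → x ≤ᵇ y ≡ true
  ≤⇒≤ᵇ {x} {y} = dec-true (x ≤? y)

  Splits : Carrier → Set
  Splits u = Any (λ a → Any (λ b → u ≤ a ∨ b × ¬ u ≤ a × ¬ u ≤ b) elements) elements

  splits? : Decidable Splits
  splits? u = any? (λ a → any? (λ b → u ≤? a ∨ b ×-dec ¬? (u ≤? a) ×-dec ¬? (u ≤? b)) elements) elements

  ¬splits⇒joinPrime : ∀ {u} → u ≢ 𝟎 → ¬ Splits u → JoinPrime u
  ¬splits⇒joinPrime {u} u≢𝟎 ¬splits = record { nonzero = u≢𝟎 ; prime = prime }
    where
    prime : ∀ a b → u ≤ a ∨ b → u ≤ a ⊎ u ≤ b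
    prime a b u≤a∨b with u ≤? a | u ≤? b
    ... | yes u≤a | _       = inj₁ u≤a
    ... | no _    | yes u≤b = inj₂ u≤b
    ... | no u≰a  | no u≰b  = ⊥-elim (¬splits (lose (∈-elements a) (lose (∈-elements b) (u≤a∨b , u≰a , u≰b))))

  joinPrime⇒¬splits : ∀ {u} → JoinPrime u → ¬ Splits u
  joinPrime⇒¬splits jp splits with find splits
  ... | a , _ , b-splits with find b-splits
  ...   | b , _ , u≤a∨b , u≰a , u≰b = [ u≰a , u≰b ]′ (JoinPrime.prime jp a b u≤a∨b)

  joinPrime? : Decidable JoinPrime
  joinPrime? u = map′ (λ (u≢𝟎 , ¬splits) → ¬splits⇒joinPrime u≢𝟎 ¬splits)
                      (λ jp → JoinPrime.nonzero jp , joinPrime⇒¬splits jp)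
                      (¬? (u ≟ 𝟎) ×-dec ¬? (splits? u))

  joinPrimes : List Carrier
  joinPrimes = filter joinPrime? elements

  ∈-joinPrimes⁻ : ∀ {p} → p ∈ joinPrimes → JoinPrime p
  ∈-joinPrimes⁻ p∈ = proj₂ (∈-filter⁻ joinPrime? {xs = elements} p∈)

  ∈-joinPrimes⁺ : ∀ {p} → JoinPrime p → p ∈ joinPrimes
  ∈-joinPrimes⁺ {p} = ∈-filter⁺ joinPrime? (∈-elements p)

  joinPrimePoset : FinitePoset Carrier
  joinPrimePoset = record
    { _≟_ = _≟_ ; points = joinPrimes ; _≤ᵇ_ = _≤ᵇ_
    ; ≤ᵇ-refl = λ _ → ≤⇒≤ᵇ ≤-refl
    ; ≤ᵇ-trans = λ _ _ _ x≤y y≤z → ≤⇒≤ᵇ (≤-trans (≤ᵇ⇒≤ x≤y) (≤ᵇ⇒≤ y≤z))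
    ; ≤ᵇ-antisym = λ _ _ x≤y y≤x → ≤-antisym (≤ᵇ⇒≤ x≤y) (≤ᵇ⇒≤ y≤x) }

  open FinitePoset joinPrimePoset public using (_<ᵇ_; <ᵇ⇒≤ᵇ; <ᵇ⇒≢; <ᵇ-intro)

  private
    count : Carrier → ℕ
    count u = length (filter (_≤? u) elements)

    count-< : ∀ {v u} → v ≤ u → v ≢ u → count v <ℕ count u
    count-< {v} {u} v≤u v≢u = length-filter-< (_≤? v) (_≤? u) elements (λ _ w≤v → ≤-trans w≤v v≤u)
      (lose (∈-elements u) (≤-refl , λ u≤v → v≢u (≤-antisym v≤u u≤v)))

    -- A splitting u ≤ a ∨ b writes u as (u ∧ a) ∨ (u ∧ b) with both parts strictly smaller.
    ≤⋁joinPrimes : ∀ n u → count u <ℕ n → u ≤ ⋁[ joinPrimePoset ] (λ r → r) ∣ (_≤ᵇ u)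
    ≤⋁joinPrimes (suc n) u (s≤s count≤n) with u ≟ 𝟎 | splits? u
    ... | yes u≡𝟎 | _          = ≤-respˡ-≡ (sym u≡𝟎) (𝟎≤ _)
    ... | no u≢𝟎  | no ¬splits = ⋁∣-upper joinPrimePoset (_≤ᵇ u) (∈-joinPrimes⁺ (¬splits⇒joinPrime u≢𝟎 ¬splits)) (≤⇒≤ᵇ ≤-refl)
    ... | no _    | yes splits with find splits
    ...   | a , _ , b-splits with find b-splits
    ...     | b , _ , u≤a∨b , u≰a , u≰b =
      ≤-respˡ-≡ (trans (sym (∧-distrib-∨ u a b)) u≤a∨b) (∨-least (part a u≰a) (part b u≰b))
      where
      part : ∀ c → ¬ u ≤ c → u ∧ c ≤ ⋁[ joinPrimePoset ] (λ r → r) ∣ (_≤ᵇ u)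
      part c u≰c = ≤-trans (≤⋁joinPrimes n (u ∧ c) (ℕ.<-≤-trans (count-< (x∧y≤x u c) u≰c) count≤n))
        (⋁∣-mono joinPrimePoset _ _ λ _ r≤u∧c → ≤⇒≤ᵇ (≤-trans (≤ᵇ⇒≤ r≤u∧c) (x∧y≤x u c)))

  ≡⋁joinPrimes-below : ∀ u → u ≡ ⋁[ joinPrimePoset ] (λ r → r) ∣ (_≤ᵇ u)
  ≡⋁joinPrimes-below u = ≤-antisym (≤⋁joinPrimes _ u (ℕ.n<1+n _)) (⋁∣-least joinPrimePoset _ λ _ → ≤ᵇ⇒≤)

  -‿≡⋁joinPrimes-below : ∀ u v → u - v ≡ ⋁[ joinPrimePoset ] (λ r → r - v) ∣ (_≤ᵇ u)
  -‿≡⋁joinPrimes-below u v = begin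
    u - v                                                      ≡⟨ cong (_- v) (≡⋁joinPrimes-below u) ⟩
    ⋁ joinPrimes (select (_≤ᵇ u) (λ r → r)) - v                ≡⟨ -‿distribʳ-⋁ joinPrimes _ v ⟩
    ⋁ joinPrimes (λ r → select (_≤ᵇ u) (λ r → r) r - v)        ≡⟨ ⋁-cong joinPrimes (select-‿distribʳ (_≤ᵇ u) (λ r → r) v) ⟩
    ⋁[ joinPrimePoset ] (λ r → r - v) ∣ (_≤ᵇ u)                ∎
    where open ≡-Reasoning

  joinPrime-≤ : ∀ {u} → u ≢ 𝟎 → Σ[ p ∈ Carrier ] p ∈ joinPrimes × p ≤ u
  joinPrime-≤ {u} u≢𝟎 with ⋁-select≢𝟎 _≟_ joinPrimes (_≤ᵇ u) (λ r → r) (u≢𝟎 ∘ trans (≡⋁joinPrimes-below u))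
  ... | p , p∈J , p≤u , _ = p , p∈J , ≤ᵇ⇒≤ p≤u

  joinPrime-≤- : ∀ {p u v} → JoinPrime p → p ≤ u - v →
                 Σ[ r ∈ Carrier ] r ∈ joinPrimes × r ≤ u × ¬ r ≤ v × p ≤ r - v
  joinPrime-≤- {p} {u} {v} jp p≤u-v with joinPrime-≤⋁-select jp (≤-respʳ-≡ (-‿≡⋁joinPrimes-below u v) p≤u-v)
  ... | r , r∈J , r≤u , p≤r-v = r , r∈J , ≤ᵇ⇒≤ r≤u
      , (λ r≤v → JoinPrime.nonzero jp (≤𝟎⇒≡𝟎 (≤-respʳ-≡ (x≤y⇒x-y≡𝟎 r≤v) p≤r-v))) , p≤r-v

  strictlyBelow : Carrier → Carrier
  strictlyBelow p = ⋁[ joinPrimePoset ] (λ r → r) ∣ (_<ᵇ p)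

  p-strictlyBelow≡p : ∀ {p} → JoinPrime p → p - strictlyBelow p ≡ p
  p-strictlyBelow≡p {p} jp = p≰u⇒p-u≡p jp λ p≤⋁ →
    let (r , _ , r<p , p≤r) = joinPrime-≤⋁-select {l = joinPrimes} {_<ᵇ p} {λ r → r} jp p≤⋁ in
    <ᵇ⇒≢ r<p (≤-antisym (≤ᵇ⇒≤ (<ᵇ⇒≤ᵇ r<p)) p≤r)

module RestrictedEmbedding {K L : CoHeyting} (fin : Finite K) (h : Embedding K L) where
  private
    module K = CoHeytingProperties K
  open FiniteCoHeyting K fin
  open CoHeytingProperties L
  open Realisations L
  open EmbeddingProperties h
  open Embedding h using (pres-∧; pres--)

  map-≡⋁ : ∀ u → map h u ≡ ⋁[ joinPrimePoset ] (map h) ∣ (_≤ᵇ u)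
  map-≡⋁ u = trans (cong (map h) (≡⋁joinPrimes-below u)) (map-⋁-select joinPrimes (λ r → r) (_≤ᵇ u))

  embedding-realisation : IsRealisation joinPrimePoset (map h)
  embedding-realisation = record
    { monotone = λ _ _ p≤q → map-mono (≤ᵇ⇒≤ p≤q)
    ; meet-≤ = meet-≤
    ; disjoint-below = disjoint-below
    ; nonzero = λ p∈J → map-≢𝟎 (K.JoinPrime.nonzero (∈-joinPrimes⁻ p∈J)) }
    where
    meet-≤ : ∀ {p q} → p ∈ joinPrimes → q ∈ joinPrimes →
             map h p ∧ map h q ≤ ⋁[ joinPrimePoset ] (map h) ∣ (λ r → r ≤ᵇ p && r ≤ᵇ q)
    meet-≤ {p} {q} _ _ = ≤-respˡ-≡ (trans (sym (map-≡⋁ (p K.∧ q))) (pres-∧ p q))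
      (⋁∣-mono joinPrimePoset _ _ λ _ r≤p∧q → &&-intro (≤⇒≤ᵇ (K.≤-trans (≤ᵇ⇒≤ r≤p∧q) (K.x∧y≤x p q)))
                                                      (≤⇒≤ᵇ (K.≤-trans (≤ᵇ⇒≤ r≤p∧q) (K.x∧y≤y p q))))
    disjoint-below : ∀ {p} → p ∈ joinPrimes → map h p - ⋁[ joinPrimePoset ] (map h) ∣ (_<ᵇ p) ≡ map h p
    disjoint-below {p} p∈J = begin
      map h p - ⋁[ joinPrimePoset ] (map h) ∣ (_<ᵇ p) ≡⟨ cong (map h p -_) (sym (map-⋁-select joinPrimes (λ r → r) (_<ᵇ p))) ⟩
      map h p - map h (strictlyBelow p)                ≡⟨ sym (pres-- p (strictlyBelow p)) ⟩
      map h (p K.- strictlyBelow p)                    ≡⟨ cong (map h) (p-strictlyBelow≡p (∈-joinPrimes⁻ p∈J)) ⟩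
      map h p                                          ∎
      where open ≡-Reasoning

module Extension {K : CoHeyting} (fin : Finite K) (L : CoHeyting) {x : CoHeyting.Carrier K → CoHeyting.Carrier L}
                 (R : Realisations.IsRealisation L (FiniteCoHeyting.joinPrimePoset K fin) x) where
  private
    module K = CoHeytingProperties K
    module RK = Realisations K
  open FiniteCoHeyting K fin
  open CoHeytingProperties L
  open Realisations L
  open IsRealisation R

  extend : K.Carrier → Carrier
  extend u = ⋁[ joinPrimePoset ] x ∣ (_≤ᵇ u)

  x≤extend : ∀ {r u} → r ∈ joinPrimes → r K.≤ u → x r ≤ extend u
  x≤extend {u = u} r∈J r≤u = ⋁∣-upper joinPrimePoset (_≤ᵇ u) r∈J (≤⇒≤ᵇ r≤u)

  extend-least : ∀ {u v} → (∀ {r} → r ∈ joinPrimes → r K.≤ u → x r ≤ v) → extend u ≤ v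
  extend-least x≤v = ⋁∣-least joinPrimePoset _ λ r∈J r≤u → x≤v r∈J (≤ᵇ⇒≤ r≤u)

  extend-mono : ∀ {u v} → u K.≤ v → extend u ≤ extend v
  extend-mono u≤v = extend-least λ r∈J r≤u → x≤extend r∈J (K.≤-trans r≤u u≤v)

  ≤ᵇ-downClosed : ∀ u → FinitePoset.DownClosed joinPrimePoset (_≤ᵇ u)
  ≤ᵇ-downClosed u _ _ r≤u r′≤r = ≤⇒≤ᵇ (K.≤-trans (≤ᵇ⇒≤ r′≤r) (≤ᵇ⇒≤ r≤u))

  -- x r meets extend v only below the join-primes strictly below r, from which x r is disjoint.
  x-extend≡x : ∀ {r v} → r ∈ joinPrimes → ¬ r K.≤ v → x r - extend v ≡ x r
  x-extend≡x {r} {v} r∈J r≰v =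
    trans (sym (x-[x∧y]≡x-y (x r) (extend v))) (x-u≡x⇒x-v≡x (disjoint-below r∈J) x∧extend≤)
    where
    x∧extend≤ : x r ∧ extend v ≤ ⋁[ joinPrimePoset ] x ∣ (_<ᵇ r)
    x∧extend≤ = ≤-trans (meet-⋁-downClosed joinPrimePoset R (_≤ᵇ v) r∈J (≤ᵇ-downClosed v))
      (⋁∣-mono joinPrimePoset _ _ λ {w} _ h → <ᵇ-intro (∧-conicalˡ (w ≤ᵇ r) _ h) λ w≡r →
        r≰v (≤ᵇ⇒≤ (subst (λ w → w ≤ᵇ v ≡ true) w≡r (∧-conicalʳ (w ≤ᵇ r) _ h))))

  extend-𝟎 : extend K.𝟎 ≡ 𝟎
  extend-𝟎 = ≤𝟎⇒≡𝟎 (extend-least λ r∈J r≤𝟎 → ⊥-elim (K.JoinPrime.nonzero (∈-joinPrimes⁻ r∈J) (K.≤𝟎⇒≡𝟎 r≤𝟎)))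

  extend-∨ : ∀ u v → extend (u K.∨ v) ≡ extend u ∨ extend v
  extend-∨ u v = ≤-antisym (extend-least x≤)
    (∨-least (extend-mono (K.x≤x∨y u v)) (extend-mono (K.y≤x∨y u v)))
    where
    x≤ : ∀ {r} → r ∈ joinPrimes → r K.≤ u K.∨ v → x r ≤ extend u ∨ extend v
    x≤ r∈J r≤u∨v with K.JoinPrime.prime (∈-joinPrimes⁻ r∈J) u v r≤u∨v
    ... | inj₁ r≤u = ≤-trans (x≤extend r∈J r≤u) (x≤x∨y _ _)
    ... | inj₂ r≤v = ≤-trans (x≤extend r∈J r≤v) (y≤x∨y _ _)

  extend-∧ : ∀ u v → extend (u K.∧ v) ≡ extend u ∧ extend v
  extend-∧ u v = ≤-antisym
    (∧-greatest (extend-mono (K.x∧y≤x u v)) (extend-mono (K.x∧y≤y u v)))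
    (≤-trans (⋁-meet-⋁-downClosed joinPrimePoset R (_≤ᵇ u) (_≤ᵇ v) (≤ᵇ-downClosed u) (≤ᵇ-downClosed v))
      (⋁∣-mono joinPrimePoset _ _ λ {r} _ h →
        ≤⇒≤ᵇ (K.∧-greatest (≤ᵇ⇒≤ (∧-conicalˡ (r ≤ᵇ u) _ h)) (≤ᵇ⇒≤ (∧-conicalʳ (r ≤ᵇ u) _ h)))))

  extend-- : ∀ u v → extend (u K.- v) ≡ extend u - extend v
  extend-- u v = ≤-antisym (extend-least x≤)
    (-least (extend u) (extend v) _ (≤-trans (extend-mono (K.-covers u v)) (≤-reflexive (extend-∨ v (u K.- v)))))
    where
    x≤ : ∀ {r} → r ∈ joinPrimes → r K.≤ u K.- v → x r ≤ extend u - extend v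
    x≤ {r} r∈J r≤u-v = below-r′ (joinPrime-≤- (∈-joinPrimes⁻ r∈J) r≤u-v)
      where
      below-r′ : (Σ[ r′ ∈ K.Carrier ] r′ ∈ joinPrimes × r′ K.≤ u × ¬ r′ K.≤ v × r K.≤ r′ K.- v) →
                 x r ≤ extend u - extend v
      below-r′ (r′ , r′∈J , r′≤u , r′≰v , r≤r′-v) =
        ≤-trans (monotone r∈J r′∈J (≤⇒≤ᵇ (K.≤-trans r≤r′-v (K.x-y≤x r′ v))))
          (≤-respˡ-≡ (x-extend≡x r′∈J r′≰v) (-‿monotoneˡ (extend v) (x≤extend r′∈J r′≤u)))

  extend-reflects-≤ : ∀ {u v} → extend u ≤ extend v → u K.≤ v
  extend-reflects-≤ {u} {v} eu≤ev = K.≤-respˡ-≡ (sym (≡⋁joinPrimes-below u))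
    (RK.⋁∣-least joinPrimePoset (_≤ᵇ u) r≤v)
    where
    r≤v : ∀ {r} → r ∈ joinPrimes → r ≤ᵇ u ≡ true → r K.≤ v
    r≤v {r} r∈J r≤u = decidable-stable (r ≤? v) λ r≰v → nonzero r∈J (trans (sym (x-extend≡x r∈J r≰v))
      (x≤y⇒x-y≡𝟎 (≤-trans (x≤extend r∈J (≤ᵇ⇒≤ r≤u)) eu≤ev)))

  extension : extend K.𝟏 ≡ 𝟏 → Embedding K L
  extension extend-𝟏 = record
    { map = extend
    ; injective = λ _ _ eu≡ev → K.≤-antisym (extend-reflects-≤ (≤-reflexive eu≡ev)) (extend-reflects-≤ (≤-reflexive (sym eu≡ev)))
    ; pres-𝟎 = extend-𝟎 ; pres-𝟏 = extend-𝟏 ; pres-∨ = extend-∨ ; pres-∧ = extend-∧ ; pres-- = extend-- }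

module DualPMorphism {K₀ K₁ : CoHeyting} (fin₀ : Finite K₀) (fin₁ : Finite K₁) (j : Embedding K₀ K₁) where
  private
    module K₀ = CoHeytingProperties K₀
    module K₁ = CoHeytingProperties K₁
    module F₀ = FiniteCoHeyting K₀ fin₀
    module F₁ = FiniteCoHeyting K₁ fin₁
    module R₀ = Realisations K₀
  open EmbeddingProperties j
  open Embedding j using (pres-𝟎; pres-𝟏; pres-∨; pres--)

  -- the least a with p ≤ j a
  dual : K₁.Carrier → K₀.Carrier
  dual p = FiniteJoins.⋀ K₀ F₀.elements (λ a → if p F₁.≤ᵇ map j a then a else K₀.𝟏)

  dual-least : ∀ {p a} → p K₁.≤ map j a → dual p K₀.≤ a
  dual-least {p} {a} p≤ja = K₀.≤-trans (FiniteJoins.⋀-lower K₀ (F₀.∈-elements a))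
    (K₀.≤-reflexive (cong (λ β → if β then a else K₀.𝟏) (F₁.≤⇒≤ᵇ p≤ja)))

  dual-above : ∀ p → p K₁.≤ map j (dual p)
  dual-above p = K₁.≤-respʳ-≡ (sym (map-⋀ F₀.elements _)) (FiniteJoins.⋀-greatest K₁ {l = F₀.elements} λ {a} _ → p≤ a)
    where
    p≤ : ∀ a → p K₁.≤ map j (if p F₁.≤ᵇ map j a then a else K₀.𝟏)
    p≤ a = bool-cases (p F₁.≤ᵇ map j a)
      (λ p≤ja → K₁.≤-respʳ-≡ (cong (λ β → map j (if β then a else K₀.𝟏)) (sym p≤ja)) (F₁.≤ᵇ⇒≤ p≤ja))
      (λ p≰ja → K₁.≤-respʳ-≡ (trans (sym pres-𝟏) (cong (λ β → map j (if β then a else K₀.𝟏)) (sym p≰ja))) (K₁.≤𝟏 p))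

  dual-mono : ∀ {p q} → p K₁.≤ q → dual p K₀.≤ dual q
  dual-mono {p} {q} p≤q = dual-least (K₁.≤-trans p≤q (dual-above q))

  dual-joinPrime : ∀ {p} → K₁.JoinPrime p → K₀.JoinPrime (dual p)
  dual-joinPrime {p} jp = record { nonzero = nonzero ; prime = prime }
    where
    nonzero : dual p ≢ K₀.𝟎
    nonzero dp≡𝟎 = K₁.JoinPrime.nonzero jp (K₁.≤𝟎⇒≡𝟎 (K₁.≤-respʳ-≡ (trans (cong (map j) dp≡𝟎) pres-𝟎) (dual-above p)))
    prime : ∀ a b → dual p K₀.≤ a K₀.∨ b → dual p K₀.≤ a ⊎ dual p K₀.≤ b
    prime a b dp≤a∨b with K₁.JoinPrime.prime jp (map j a) (map j b)
                            (K₁.≤-trans (dual-above p) (K₁.≤-respʳ-≡ (pres-∨ a b) (map-mono dp≤a∨b)))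
    ... | inj₁ p≤ja = inj₁ (dual-least p≤ja)
    ... | inj₂ p≤jb = inj₂ (dual-least p≤jb)

  -- With u the join of the join-primes strictly below s, j s = j s - j u, so p lies below some
  -- join-prime r ≤ j s with r ≰ j u; then dual r ≤ s, and dual r < s would give r ≤ j u.
  fibre-above : ∀ {p s} → K₁.JoinPrime p → K₀.JoinPrime s → p K₁.≤ map j s →
                Σ[ r ∈ K₁.Carrier ] r ∈ F₁.joinPrimes × p K₁.≤ r × dual r ≡ s
  fibre-above {p} {s} jp js p≤js = in-fibre (F₁.joinPrime-≤- jp (K₁.≤-respʳ-≡ js≡js-ju p≤js))
    where
    u = F₀.strictlyBelow s
    js≡js-ju : map j s ≡ map j s K₁.- map j u
    js≡js-ju = trans (cong (map j) (sym (F₀.p-strictlyBelow≡p js))) (pres-- s u)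
    in-fibre : (Σ[ r ∈ K₁.Carrier ] r ∈ F₁.joinPrimes × r K₁.≤ map j s × ¬ r K₁.≤ map j u × p K₁.≤ r K₁.- map j u) →
               Σ[ r ∈ K₁.Carrier ] r ∈ F₁.joinPrimes × p K₁.≤ r × dual r ≡ s
    in-fibre (r , r∈J , r≤js , r≰ju , p≤r-ju) = r , r∈J , K₁.≤-trans p≤r-ju (K₁.x-y≤x r _) ,
      decidable-stable (dual r F₀.≟ s) λ dr≢s → r≰ju (K₁.≤-trans (dual-above r) (map-mono
        (R₀.⋁∣-upper F₀.joinPrimePoset {x = λ v → v} (F₀._<ᵇ s) (F₀.∈-joinPrimes⁺ (dual-joinPrime (F₁.∈-joinPrimes⁻ r∈J)))
          (F₀.<ᵇ-intro (F₀.≤⇒≤ᵇ (dual-least r≤js)) dr≢s))))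

  dual-pMorphism : IsPMorphism F₁.joinPrimePoset F₀.joinPrimePoset dual
  dual-pMorphism = record
    { f-∈ = F₀.∈-joinPrimes⁺ ∘ dual-joinPrime ∘ F₁.∈-joinPrimes⁻
    ; monotone = λ _ _ p≤q → F₀.≤⇒≤ᵇ (dual-mono (F₁.≤ᵇ⇒≤ p≤q))
    ; lift = lift
    ; surjective = surjective }
    where
    lift : ∀ {p s} → p ∈ F₁.joinPrimes → s ∈ F₀.joinPrimes → dual p F₀.≤ᵇ s ≡ true →
           Σ[ q ∈ K₁.Carrier ] q ∈ F₁.joinPrimes × p F₁.≤ᵇ q ≡ true × dual q ≡ s
    lift {p} p∈J s∈J dp≤s =
      let (r , r∈J , p≤r , dr≡s) = fibre-above (F₁.∈-joinPrimes⁻ p∈J) (F₀.∈-joinPrimes⁻ s∈J)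
                                     (K₁.≤-trans (dual-above p) (map-mono (F₀.≤ᵇ⇒≤ dp≤s)))
      in r , r∈J , F₁.≤⇒≤ᵇ p≤r , dr≡s
    surjective : ∀ {s} → s ∈ F₀.joinPrimes → Σ[ q ∈ K₁.Carrier ] q ∈ F₁.joinPrimes × dual q ≡ s
    surjective s∈J =
      let (p , p∈J , p≤js) = F₁.joinPrime-≤ (map-≢𝟎 (K₀.JoinPrime.nonzero (F₀.∈-joinPrimes⁻ s∈J)))
          (r , r∈J , _ , dr≡s) = fibre-above (F₁.∈-joinPrimes⁻ p∈J) (F₀.∈-joinPrimes⁻ s∈J) p≤js
      in r , r∈J , dr≡s

module ExtensionAlongDual (L : CoHeyting) {L₀ L₁ : CoHeyting} (fin₀ : Finite L₀) (fin₁ : Finite L₁)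
                          (i : Embedding L₀ L) (j : Embedding L₀ L₁)
                          {x : CoHeyting.Carrier L₁ → CoHeyting.Carrier L}
                          (R : Realisations.IsRealisation L (FiniteCoHeyting.joinPrimePoset L₁ fin₁) x)
                          (commutes : Lifting.Commutes L (FiniteCoHeyting.joinPrimePoset L₁ fin₁)
                                        (FiniteCoHeyting.joinPrimePoset L₀ fin₀) (DualPMorphism.dual fin₀ fin₁ j) (map i) x)
                          where
  private
    module L₀ = CoHeytingProperties L₀
    module L₁ = CoHeytingProperties L₁
    module F₀ = FiniteCoHeyting L₀ fin₀
    module F₁ = FiniteCoHeyting L₁ fin₁
    module Ei = EmbeddingProperties i
    module Ej = EmbeddingProperties j
  open CoHeytingProperties L
  open Realisations L
  open DualPMorphism fin₀ fin₁ j
  open Extension fin₁ L R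
  open RestrictedEmbedding fin₀ i using (map-≡⋁)

  extend-map-j : ∀ a → extend (map j a) ≡ map i a
  extend-map-j a = ≤-antisym
    (extend-least λ {r} r∈J r≤ja → ≤-trans
      (≤-respʳ-≡ (sym (commutes (dual-in r∈J))) (⋁∣-upper F₁.joinPrimePoset (λ q → dual q F₀.≤ᵇ dual r) r∈J (F₀.≤⇒≤ᵇ L₀.≤-refl)))
      (Ei.map-mono (dual-least r≤ja)))
    (≤-respˡ-≡ (sym (map-≡⋁ a)) (⋁∣-least F₀.joinPrimePoset _ λ {s} s∈J s≤a →
      ≤-respˡ-≡ (sym (commutes s∈J)) (⋁∣-least F₁.joinPrimePoset _ λ {q} q∈J dq≤s →
        x≤extend q∈J (L₁.≤-trans (dual-above q) (Ej.map-mono (L₀.≤-trans (F₀.≤ᵇ⇒≤ dq≤s) (F₀.≤ᵇ⇒≤ s≤a)))))))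
    where
    dual-in : ∀ {r} → r ∈ F₁.joinPrimes → dual r ∈ F₀.joinPrimes
    dual-in = IsPMorphism.f-∈ dual-pMorphism

theorem4p4 : (L : CoHeyting) → D1 L → S1 L →
    (L₀ : CoHeyting) → Finite L₀ → (i : Embedding L₀ L) →
    (L₁ : CoHeyting) → Finite L₁ → (j : Embedding L₀ L₁) →
    Σ (Embedding L₁ L) λ e → ∀ x → map e (map j x) ≡ map i x
theorem4p4 L d1 s1 L₀ fin₀ i L₁ fin₁ j = extension extend-𝟏 , extend-map-j
  where
  open DualPMorphism fin₀ fin₁ j using (dual-pMorphism)
  lifted = Lifting.lift-realisation L d1 s1 _ (ℕ.n<1+n _) dual-pMorphism (RestrictedEmbedding.embedding-realisation fin₀ i)
  open Extension fin₁ L (proj₁ (proj₂ lifted))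
  open ExtensionAlongDual L fin₀ fin₁ i j (proj₁ (proj₂ lifted)) (proj₂ (proj₂ lifted))
  extend-𝟏 : extend (CoHeyting.𝟏 L₁) ≡ CoHeyting.𝟏 L
  extend-𝟏 = trans (cong extend (sym (Embedding.pres-𝟏 j))) (trans (extend-map-j _) (Embedding.pres-𝟏 i))
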